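{- Let $G$ be a graph with $n$ vertices and $m$ edges, and let $\rho$ be a positive integer. There exists $h\in O(m^2)$ and a quantum gate OPCM that, on every input basis state $\ket{f(\phi)}\ket{x}\ket{0_h}\ket{ - }$ (with $\phi\in\{0,1\}^{n\log n}$), produces the output $(-1)^{g(x)f(\phi)}\ket{f(\phi)}\ket{x}\ket{0_h}\ket{ - }$, where $g(x)=1$ exactly when $\Pi(x)$ is not degenerate and the 1-page layout of $G$ defined by $\Pi(x)$ has at most $\rho$ crossings. OPCM has $O(n^8)$ circuit complexity, $O(n^6)$ depth, and $O(m^2)$ width.
   Context: $\log k$ denotes $\lceil\log_2 k\rceil$; $\ket{0_j}$ is $j$ qubits in $\ket{0}$; $\ket{ - }=(\ket0-\ket1)/\sqrt2$. $G$ has vertices $v_0,\dots,v_{n-1}$. $\phi$ is read as integers $\phi[0],\dots,\phi[n-1]$ of $\log n$ bits; $f(\phi)=1$ iff these form a permutation of $\{0,\dots,n-1\}$. For $0\le i<j\le n-1$, $x_{i,j}=1$ iff $\phi[i]<\phi[j]$, and $\ket{x}=\ket{x_{0,1}}\dots\ket{x_{n-2,n-1}}$. If $f(\phi)=1$, $\Pi(x)$ is the linear order of the vertices (along the spine) in which, for $i<j$, $v_i$ precedes $v_j$ iff $x_{i,j}=1$; otherwise $\Pi(x)$ is degenerate. In the 1-page layout defined by $\Pi(x)$, two edges without a common endpoint cross iff exactly one endpoint of one lies strictly between the endpoints of the other in $\Pi(x)$. Circuit complexity is the number of elementary gates; a circuit is modeled as a DAG of gates weighted by their number of elementary gates, edges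 being qubit dependencies; depth is the number of vertices on a longest path; width is the maximum total weight of an anti-chain (maximal set of pairwise incomparable vertices). -}

module Defs where

open import Data.Bool using (Bool; true; false; not; _∧_; _∨_; if_then_else_; T)
import Data.Bool as B
open import Data.Nat using (ℕ; zero; suc; _+_; _*_; _^_; _≤_; _<_; _<ᵇ_; _≡ᵇ_; _≤ᵇ_)
open import Data.Nat.Logarithm using (⌈log₂_⌉)
open import Data.Fin using (Fin; toℕ)
open import Data.Fin.Properties using () renaming (_≟_ to _≟F_)
open import Data.Integer using (ℤ; +_; -_)
open import Data.List using (List; []; _∷_; length; map; concatMap; filterᵇ; allFin)
import Data.List as L
open import Data.List.Relation.Unary.AllPairs using (AllPairs)
open import Data.List.Relation.Unary.All using (All)
open import Data.List.Relation.Unary.Unique.Propositional using (Unique)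
open import Data.Vec using (Vec; []; _∷_; lookup; replicate; _++_; _[_]%=_; fromList)
import Data.Vec as V
open import Data.Vec.Properties using (≡-dec)
open import Data.Product using (_×_; _,_; Σ; proj₁; proj₂)
open import Data.Empty using (⊥)
open import Relation.Nullary using (¬_; Dec; yes; no; does)
open import Relation.Binary.PropositionalEquality using (_≡_; _≢_)

logn : ℕ → ℕ
logn n = ⌈log₂ n ⌉

-- φ ∈ {0,1}^{n log n}, grouped into the n integers φ[0..n-1] of log n bits
Phi : ℕ → Set
Phi n = Vec (Vec Bool (logn n)) n

bitsToℕ : ∀ {k} → Vec Bool k → ℕ
bitsToℕ = V.foldl (λ _ → ℕ) (λ acc b → 2 * acc + (if b then 1 else 0)) 0

val : ∀ {n} → Phi n → Fin n → ℕ
val φ i = bitsToℕ (lookup φ i)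

allB : {A : Set} → (A → Bool) → List A → Bool
allB p [] = true
allB p (x ∷ xs) = p x ∧ allB p xs

-- f(φ) = 1 iff φ[0],...,φ[n-1] form a permutation of {0,...,n-1}
-- (all values < n and pairwise distinct)
fPhi : ∀ {n} → Phi n → Bool
fPhi {n} φ =
  allB (λ i → val φ i <ᵇ n) (allFin n) ∧
  allB (λ i → allB (λ j → not (toℕ i <ᵇ toℕ j) ∨ not (val φ i ≡ᵇ val φ j)) (allFin n)) (allFin n)

-- x_{i,j} = 1 iff φ[i] < φ[j]   (meaningful for i < j)
xbit : ∀ {n} → Phi n → Fin n → Fin n → Bool
xbit φ i j = val φ i <ᵇ val φ j

pairs : (n : ℕ) → List (Fin n × Fin n)
pairs n = concatMap (λ i → map (λ j → (i , j)) (filterᵇ (λ j → toℕ i <ᵇ toℕ j) (allFin n))) (allFin n)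

numPairs : ℕ → ℕ
numPairs n = length (pairs n)

-- |x> = |x_{0,1}> ... |x_{n-2,n-1}>
xVec : ∀ {n} → Phi n → Vec Bool (numPairs n)
xVec {n} φ = V.map (λ p → xbit φ (proj₁ p) (proj₂ p)) (fromList (pairs n))

-- u precedes v in Π(x): for i<j, v_i precedes v_j iff x_{i,j}=1
precedes : ∀ {n} → Phi n → Fin n → Fin n → Bool
precedes φ u v =
  if toℕ u <ᵇ toℕ v then xbit φ u v
  else (if toℕ v <ᵇ toℕ u then not (xbit φ v u) else false)

record Graph (n : ℕ) : Set where
  field
    edges    : List (Fin n × Fin n)
    ordered  : All (λ e → toℕ (proj₁ e) < toℕ (proj₂ e)) edges
    noDup    : Unique edges

numEdges : ∀ {n} → Graph n → ℕ
numEdges G = length (Graph.edges G)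

_==_ : ∀ {n} → Fin n → Fin n → Bool
a == b = does (a ≟F b)

between : ∀ {n} → Phi n → Fin n → Fin n → Fin n → Bool
between φ c a b = (precedes φ a c ∧ precedes φ c b) ∨ (precedes φ b c ∧ precedes φ c a)

crosses : ∀ {n} → Phi n → Fin n × Fin n → Fin n × Fin n → Bool
crosses φ (a , b) (c , d) =
  not (a == c ∨ a == d ∨ b == c ∨ b == d) ∧
  B._xor_ (between φ c a b) (between φ d a b)

crossCount : ∀ {n} → Phi n → List (Fin n × Fin n) → ℕ
crossCount φ [] = 0
crossCount φ (e ∷ es) = length (filterᵇ (crosses φ e) es) + crossCount φ es

-- g(x) = 1 iff Π(x) is not degenerate (i.e. f(φ) = 1) and the 1-page layout
-- defined by Π(x) has at most ρ crossings
gX : ∀ {n} → Graph n → ℕ → Phi n → Bool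
gX G ρ φ = fPhi φ ∧ (crossCount φ (Graph.edges G) ≤ᵇ ρ)

data Gate (w : ℕ) : Set where
  NOT     : Fin w → Gate w
  CNOT    : (c t : Fin w) → c ≢ t → Gate w
  TOFFOLI : (c₁ c₂ t : Fin w) → c₁ ≢ c₂ → c₁ ≢ t → c₂ ≢ t → Gate w

Circuit : ℕ → Set
Circuit w = List (Gate w)

wires : ∀ {w} → Gate w → List (Fin w)
wires (NOT i) = i ∷ []
wires (CNOT c t _) = c ∷ t ∷ []
wires (TOFFOLI c₁ c₂ t _ _ _) = c₁ ∷ c₂ ∷ t ∷ []

flipAt : ∀ {w} → Fin w → Vec Bool w → Vec Bool w
flipAt i b = b [ i ]%= not

basisAct : ∀ {w} → Gate w → Vec Bool w → Vec Bool w
basisAct (NOT i) b = flipAt i b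
basisAct (CNOT c t _) b = if lookup b c then flipAt t b else b
basisAct (TOFFOLI c₁ c₂ t _ _ _) b = if lookup b c₁ ∧ lookup b c₂ then flipAt t b else b

-- states: amplitude vectors over the computational basis.  All states occurring
-- here have amplitudes in (1/√2)ℤ; we store them scaled by √2 (the action is linear).
State : ℕ → Set
State w = Vec Bool w → ℤ

-- linear action of a permutation gate U|b> = |π b> with π an involution:
-- (Uψ)(b) = ψ(π b)
applyGate : ∀ {w} → Gate w → State w → State w
applyGate g ψ b = ψ (basisAct g b)

run : ∀ {w} → Circuit w → State w → State w
run [] ψ = ψ
run (g ∷ C) ψ = run C (applyGate g ψ)

-- Cost measures: DAG of gates (each weight 1 = one elementary gate),
-- edge from gate i to a later gate j when they share a qubit.

gateAt : ∀ {w} (C : Circuit w) → Fin (length C) → Gate w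
gateAt C i = L.lookup C i

Shares : ∀ {w} → Gate w → Gate w → Set
Shares g g' = Σ _ (λ q → Data.List.Membership.Propositional._∈_ q (wires g) × Data.List.Membership.Propositional._∈_ q (wires g'))
  where import Data.List.Membership.Propositional

Dep : ∀ {w} (C : Circuit w) → Fin (length C) → Fin (length C) → Set
Dep C i j = toℕ i < toℕ j × Shares (gateAt C i) (gateAt C j)

-- Path C i k len : a path from gate i to gate k in the DAG with len vertices
data Path {w} (C : Circuit w) : Fin (length C) → Fin (length C) → ℕ → Set where
  here : ∀ i → Path C i i 1
  step : ∀ {i j k len} → Dep C i j → Path C j k len → Path C i k (suc len)

complexity : ∀ {w} → Circuit w → ℕ
complexity C = length C

DepthAtMost : ∀ {w} → Circuit w → ℕ → Set
DepthAtMost C D = ∀ i k len → Path C i k len → len ≤ D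

Incomparable : ∀ {w} (C : Circuit w) → Fin (length C) → Fin (length C) → Set
Incomparable C i j = i ≢ j × (∀ len → ¬ Path C i j len) × (∀ len → ¬ Path C j i len)

WidthAtMost : ∀ {w} → Circuit w → ℕ → Set
WidthAtMost C W = ∀ (A : List (Fin (length C))) → AllPairs (Incomparable C) A → length A ≤ W

regWidth : ℕ → ℕ → ℕ
regWidth n h = 1 + (numPairs n + (h + 1))

basisIn : ∀ {n} → Phi n → (h : ℕ) → Bool → Vec Bool (regWidth n h)
basisIn φ h b = fPhi φ ∷ (xVec φ ++ (replicate h false ++ (b ∷ [])))

indicator : ∀ {w} → Vec Bool w → State w
indicator v b = if does (≡-dec B._≟_ v b) then + 1 else + 0

-- √2 · |f(φ)>|x>|0_h>|->  =  |f(φ)>|x>|0_h>|0>  -  |f(φ)>|x>|0_h>|1>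
inputState : ∀ {n} → Phi n → (h : ℕ) → State (regWidth n h)
inputState φ h b = indicator (basisIn φ h false) b Data.Integer.+ (- indicator (basisIn φ h true) b)
  where import Data.Integer

sign : Bool → ℤ → ℤ
sign true z = - z
sign false z = z

module Submission where

-- A straight-line program of xor-assignments  t ⊕= F  (F a Boolean formula over the
-- φ- and x-qubits) adds, for every pair of edges, the bit "they cross under Π(x)" to a
-- binary counter started at 2^B - (min(ρ, P) + 1), where P ≤ m² is the number of edge
-- pairs and B = min(P, 4n) bits suffice because P < 2^B.  The counter's top bit stays
-- clear exactly when there are at most ρ crossings, so the program can write
-- g(x) f(φ) = f(φ) ∧ ¬top into a result qubit.  Each formula is compiled with Bennett's
-- trick into NOT/CNOT/Toffoli gates on four scratch qubits, giving O(P·B) = O(n⁵) gates.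
-- Copying the result into a hub qubit, CNOT-ing the hub into the |−⟩ target and running
-- the computation backwards yields the phase (-1)^{g f} (phase kickback).  Finally every
-- gate is routed through the hub, which turns the gate DAG into a chain: its width is 1
-- and its depth is the gate count.

open import Defs
open import Data.Bool using (Bool; true; false; not; _∧_; _∨_; _xor_; if_then_else_; T)
open import Data.Bool.Properties using (not-involutive; xor-same; xor-assoc; xor-comm; xor-identityʳ; ∧-identityʳ; T-≡)
import Data.Bool as Bool
open import Data.Nat using (ℕ; zero; suc; _+_; _*_; _^_; _∸_; ⌊_/2⌋; _⊔_; _⊓_)
open import Data.Nat using (_≤_; _<_; z≤n; s≤s; z<s; s≤s⁻¹; _≟_; _≤?_; _<?_; _<ᵇ_; _≤ᵇ_)
open import Data.Nat.Properties
open import Data.Nat.Tactic.RingSolver using (solve-∀)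
open import Data.Fin using (Fin; toℕ; fromℕ<; combine) renaming (zero to fzero; suc to fsuc)
open import Data.Fin.Properties using (toℕ-fromℕ<; toℕ-injective; toℕ<n; injective⇒≤; combine-injective) renaming (_≟_ to _≟ᶠ_)
open import Data.List using (List; []; _∷_; _++_; [_]; reverse; length; map; filterᵇ; allFin)
import Data.List as List
open import Data.List.Properties using (length-++; length-map; length-reverse; unfold-reverse; length-filter)
open import Data.List.Relation.Unary.All using (All; []; _∷_)
import Data.List.Relation.Unary.All as All
open import Data.List.Relation.Unary.All.Properties using (++⁺)
open import Data.List.Relation.Unary.AllPairs using (AllPairs; []; _∷_)
open import Data.List.Relation.Unary.Any using (here; there; index)
import Data.List.Relation.Unary.Any as Any
open import Data.List.Relation.Unary.Any.Properties using (lookup-index)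
open import Data.List.Membership.Propositional using (_∈_)
open import Data.List.Membership.Propositional.Properties using (∈-allFin; ∈-filter⁺; ∈-map⁺; ∈-concatMap⁺; ∈-lookup)
open import Data.Vec using (Vec; []; _∷_; lookup; replicate; fromList)
import Data.Vec as Vec
open import Data.Vec.Properties using (lookup∘updateAt; lookup∘updateAt′; lookup-map) renaming (≡-dec to ≡-decᵛ)
open import Data.Integer using (-_) renaming (_+_ to _+ℤ_)
open import Data.Integer.Properties using (neg-distrib-+; neg-involutive) renaming (+-comm to +ℤ-comm)
open import Data.Product using (Σ; _×_; _,_; proj₁; proj₂)
open import Data.Product.Properties using () renaming (≡-dec to ≡-decˣ)
open import Data.Sum using (_⊎_; inj₁; inj₂)
open import Data.Unit using (⊤; tt)
open import Data.Empty using (⊥-elim)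
open import Relation.Nullary using (Dec; yes; no)
open import Relation.Nullary.Decidable using (T?)
open import Relation.Binary.Definitions using (tri<; tri≈; tri>)
open import Relation.Binary.PropositionalEquality hiding ([_])
open import Function using (_∘_; Equivalence)

lookup-fromList : ∀ {A : Set} (xs : List A) (i : Fin (length xs)) → lookup (fromList xs) i ≡ List.lookup xs i
lookup-fromList (x ∷ xs) fzero = refl
lookup-fromList (x ∷ xs) (fsuc i) = lookup-fromList xs i

All-reverse : ∀ {A : Set} {P : A → Set} {xs : List A} → All P xs → All P (reverse xs)
All-reverse {xs = []} [] = []
All-reverse {xs = x ∷ xs} (px ∷ pxs) rewrite unfold-reverse x xs = ++⁺ (All-reverse pxs) (px ∷ [])

lookup-injective : ∀ {A : Set} (xs : List A) → AllPairs _≢_ xs → ∀ i j → List.lookup xs i ≡ List.lookup xs j → i ≡ j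
lookup-injective (x ∷ xs) (x∉ ∷ _) fzero fzero _ = refl
lookup-injective (x ∷ xs) (x∉ ∷ _) fzero (fsuc j) e = ⊥-elim (All.lookup x∉ (∈-lookup j) e)
lookup-injective (x ∷ xs) (x∉ ∷ _) (fsuc i) fzero e = ⊥-elim (All.lookup x∉ (∈-lookup i) (sym e))
lookup-injective (x ∷ xs) (_ ∷ unique) (fsuc i) (fsuc j) e = cong fsuc (lookup-injective xs unique i j e)

-- Bits addressed by natural numbers; positions past the end read as false.
nth : ∀ {k} → Vec Bool k → ℕ → Bool
nth [] q = false
nth (x ∷ xs) zero = x
nth (x ∷ xs) (suc q) = nth xs q

lookup≡nth : ∀ {k} (v : Vec Bool k) (i : Fin k) → lookup v i ≡ nth v (toℕ i)
lookup≡nth (x ∷ v) fzero = refl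
lookup≡nth (x ∷ v) (fsuc i) = lookup≡nth v i

nth-flipAt-same : ∀ {k} (v : Vec Bool k) (i : Fin k) → nth (flipAt i v) (toℕ i) ≡ not (nth v (toℕ i))
nth-flipAt-same (x ∷ v) fzero = refl
nth-flipAt-same (x ∷ v) (fsuc i) = nth-flipAt-same v i

nth-flipAt-other : ∀ {k} (v : Vec Bool k) (i : Fin k) q → q ≢ toℕ i → nth (flipAt i v) q ≡ nth v q
nth-flipAt-other (x ∷ v) fzero zero ne = ⊥-elim (ne refl)
nth-flipAt-other (x ∷ v) fzero (suc q) ne = refl
nth-flipAt-other (x ∷ v) (fsuc i) zero ne = refl
nth-flipAt-other (x ∷ v) (fsuc i) (suc q) ne = nth-flipAt-other v i q (λ e → ne (cong suc e))

nth-ext : ∀ {k} (u v : Vec Bool k) → (∀ q → q < k → nth u q ≡ nth v q) → u ≡ v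
nth-ext [] [] h = refl
nth-ext (x ∷ u) (y ∷ v) h = cong₂ _∷_ (h 0 z<s) (nth-ext u v (λ q q< → h (suc q) (s≤s q<)))

nth-++ˡ : ∀ {k l} (xs : Vec Bool k) (ys : Vec Bool l) i → i < k → nth (xs Vec.++ ys) i ≡ nth xs i
nth-++ˡ (x ∷ xs) ys zero lt = refl
nth-++ˡ (x ∷ xs) ys (suc i) (s≤s lt) = nth-++ˡ xs ys i lt

nth-++ʳ : ∀ {k l} (xs : Vec Bool k) (ys : Vec Bool l) i → nth (xs Vec.++ ys) (k + i) ≡ nth ys i
nth-++ʳ [] ys i = refl
nth-++ʳ (x ∷ xs) ys i = nth-++ʳ xs ys i

nth-replicate-false : ∀ k i → nth (replicate k false) i ≡ false
nth-replicate-false zero i = refl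
nth-replicate-false (suc k) zero = refl
nth-replicate-false (suc k) (suc i) = nth-replicate-false k i

flipAt-involutive : ∀ {k} (i : Fin k) (v : Vec Bool k) → flipAt i (flipAt i v) ≡ v
flipAt-involutive fzero (x ∷ v) = cong (_∷ v) (not-involutive x)
flipAt-involutive (fsuc i) (x ∷ v) = cong (x ∷_) (flipAt-involutive i v)

flipAt-comm : ∀ {k} (i j : Fin k) (v : Vec Bool k) → flipAt i (flipAt j v) ≡ flipAt j (flipAt i v)
flipAt-comm fzero fzero v = refl
flipAt-comm fzero (fsuc j) (x ∷ v) = refl
flipAt-comm (fsuc i) fzero (x ∷ v) = refl
flipAt-comm (fsuc i) (fsuc j) (x ∷ v) = cong (x ∷_) (flipAt-comm i j v)

lookup-flipAt-other : ∀ {k} (v : Vec Bool k) (i j : Fin k) → j ≢ i → lookup (flipAt i v) j ≡ lookup v j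
lookup-flipAt-other v i j ne = lookup∘updateAt′ j i ne v

-- Reversible circuits

module Reversible {w : ℕ} where

  basisAct-involutive : (g : Gate w) (s : Vec Bool w) → basisAct g (basisAct g s) ≡ s
  basisAct-involutive (NOT i) s = flipAt-involutive i s
  basisAct-involutive (CNOT c t ne) s with lookup s c in eq
  ... | false rewrite eq = refl
  ... | true rewrite lookup-flipAt-other s t c ne | eq = flipAt-involutive t s
  basisAct-involutive (TOFFOLI a b t ab at bt) s with lookup s a in ea | lookup s b in eb
  ... | false | _ rewrite ea = refl
  ... | true | false rewrite ea | eb = refl
  ... | true | true rewrite lookup-flipAt-other s t a at | lookup-flipAt-other s t b bt | ea | eb = flipAt-involutive t s

  fwd : Circuit w → Vec Bool w → Vec Bool w
  fwd [] s = s
  fwd (g ∷ C) s = fwd C (basisAct g s)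

  bwd : Circuit w → Vec Bool w → Vec Bool w
  bwd [] s = s
  bwd (g ∷ C) s = basisAct g (bwd C s)

  run≡∘bwd : (C : Circuit w) (ψ : State w) (b : Vec Bool w) → run C ψ b ≡ ψ (bwd C b)
  run≡∘bwd [] ψ b = refl
  run≡∘bwd (g ∷ C) ψ b = run≡∘bwd C (applyGate g ψ) b

  bwd∘fwd : (C : Circuit w) → ∀ s → bwd C (fwd C s) ≡ s
  bwd∘fwd [] s = refl
  bwd∘fwd (g ∷ C) s = trans (cong (basisAct g) (bwd∘fwd C (basisAct g s))) (basisAct-involutive g s)

  fwd∘bwd : (C : Circuit w) → ∀ s → fwd C (bwd C s) ≡ s
  fwd∘bwd [] s = refl
  fwd∘bwd (g ∷ C) s = trans (cong (fwd C) (basisAct-involutive g (bwd C s))) (fwd∘bwd C s)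

  fwd≡⇒bwd≡ : (C : Circuit w) → ∀ {u s} → fwd C u ≡ s → bwd C s ≡ u
  fwd≡⇒bwd≡ C {u} refl = bwd∘fwd C u

  fwd-++ : (C D : Circuit w) → ∀ s → fwd (C ++ D) s ≡ fwd D (fwd C s)
  fwd-++ [] D s = refl
  fwd-++ (g ∷ C) D s = fwd-++ C D (basisAct g s)

  bwd-++ : (C D : Circuit w) → ∀ s → bwd (C ++ D) s ≡ bwd C (bwd D s)
  bwd-++ [] D s = refl
  bwd-++ (g ∷ C) D s = cong (basisAct g) (bwd-++ C D s)

  fwd-reverse : (C : Circuit w) → ∀ s → fwd (reverse C) s ≡ bwd C s
  fwd-reverse [] s = refl
  fwd-reverse (g ∷ C) s rewrite unfold-reverse g C =
    trans (fwd-++ (reverse C) [ g ] s) (cong (basisAct g) (fwd-reverse C s))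

  bwd-reverse : (C : Circuit w) → ∀ s → bwd (reverse C) s ≡ fwd C s
  bwd-reverse [] s = refl
  bwd-reverse (g ∷ C) s rewrite unfold-reverse g C =
    trans (bwd-++ (reverse C) [ g ] s) (bwd-reverse C (basisAct g s))

  Avoids : Fin w → Gate w → Set
  Avoids q g = All (_≢ q) (wires g)

  basisAct-flipAt : (g : Gate w) (q : Fin w) → Avoids q g → ∀ s → basisAct g (flipAt q s) ≡ flipAt q (basisAct g s)
  basisAct-flipAt (NOT i) q (iq ∷ []) s = flipAt-comm i q s
  basisAct-flipAt (CNOT c t ne) q (cq ∷ tq ∷ []) s rewrite lookup-flipAt-other s q c cq with lookup s c
  ... | true = flipAt-comm t q s
  ... | false = refl
  basisAct-flipAt (TOFFOLI a b t _ _ _) q (aq ∷ bq ∷ tq ∷ []) s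
    rewrite lookup-flipAt-other s q a aq | lookup-flipAt-other s q b bq with lookup s a ∧ lookup s b
  ... | true = flipAt-comm t q s
  ... | false = refl

  lookup-basisAct : (g : Gate w) (q : Fin w) → Avoids q g → ∀ s → lookup (basisAct g s) q ≡ lookup s q
  lookup-basisAct (NOT i) q (iq ∷ []) s = lookup-flipAt-other s i q (λ e → iq (sym e))
  lookup-basisAct (CNOT c t ne) q (cq ∷ tq ∷ []) s with lookup s c
  ... | true = lookup-flipAt-other s t q (λ e → tq (sym e))
  ... | false = refl
  lookup-basisAct (TOFFOLI a b t _ _ _) q (aq ∷ bq ∷ tq ∷ []) s with lookup s a ∧ lookup s b
  ... | true = lookup-flipAt-other s t q (λ e → tq (sym e))
  ... | false = refl

  fwd-flipAt : (C : Circuit w) (q : Fin w) → All (Avoids q) C → ∀ s → fwd C (flipAt q s) ≡ flipAt q (fwd C s)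
  fwd-flipAt [] q [] s = refl
  fwd-flipAt (g ∷ C) q (f ∷ fC) s rewrite basisAct-flipAt g q f s = fwd-flipAt C q fC (basisAct g s)

  fwd-conjugate : ∀ (A B T : Circuit w) {s s₁ s₂ s₃ s₄ s₅} →
    fwd A s ≡ s₁ → fwd B s₁ ≡ s₂ → fwd T s₂ ≡ s₃ → bwd B s₃ ≡ s₄ → bwd A s₄ ≡ s₅ →
    fwd (A ++ (B ++ (T ++ (reverse B ++ reverse A)))) s ≡ s₅
  fwd-conjugate A B T {s} refl refl refl refl refl =
    begin
      fwd (A ++ (B ++ (T ++ (reverse B ++ reverse A)))) s
    ≡⟨ fwd-++ A _ s ⟩
      fwd (B ++ (T ++ (reverse B ++ reverse A))) (fwd A s)
    ≡⟨ fwd-++ B _ (fwd A s) ⟩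
      fwd (T ++ (reverse B ++ reverse A)) (fwd B (fwd A s))
    ≡⟨ fwd-++ T _ _ ⟩
      fwd (reverse B ++ reverse A) s₃
    ≡⟨ fwd-++ (reverse B) (reverse A) s₃ ⟩
      fwd (reverse A) (fwd (reverse B) s₃)
    ≡⟨ trans (fwd-reverse A _) (cong (bwd A) (fwd-reverse B s₃)) ⟩
      bwd A (bwd B s₃)
    ∎
    where
      open ≡-Reasoning
      s₃ = fwd T (fwd B (fwd A s))

-- Phase kickback

module PhaseKickback {w : ℕ} (L : Circuit w) (H T : Fin w) (H≢T : H ≢ T) (I : Bool → Vec Bool w) (g : Bool)
  (L-avoids-T : All (Reversible.Avoids T) L)
  (flipAt-I : ∀ β → flipAt T (I β) ≡ I (not β))
  (hub-I : ∀ β → lookup (Reversible.fwd L (I β)) H ≡ g) where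
  open Reversible {w}

  kick : Gate w
  kick = CNOT H T H≢T

  π : Vec Bool w → Vec Bool w
  π b = bwd L (basisAct kick (fwd L b))

  bwd-kickback : ∀ b → bwd (L ++ kick ∷ reverse L) b ≡ π b
  bwd-kickback b = trans (bwd-++ L (kick ∷ reverse L) b) (cong (λ v → bwd L (basisAct kick v)) (bwd-reverse L b))

  π-involutive : ∀ b → π (π b) ≡ b
  π-involutive b = begin
      bwd L (basisAct kick (fwd L (bwd L (basisAct kick (fwd L b)))))
    ≡⟨ cong (λ v → bwd L (basisAct kick v)) (fwd∘bwd L _) ⟩
      bwd L (basisAct kick (basisAct kick (fwd L b)))
    ≡⟨ cong (bwd L) (basisAct-involutive kick (fwd L b)) ⟩
      bwd L (fwd L b)
    ≡⟨ bwd∘fwd L b ⟩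
      b
    ∎
    where open ≡-Reasoning

  π-I : ∀ β → π (I β) ≡ (if g then I (not β) else I β)
  π-I β = flip-if-set g (hub-I β)
    where
      flip-if-set : ∀ g' → lookup (fwd L (I β)) H ≡ g' → π (I β) ≡ (if g' then I (not β) else I β)
      flip-if-set true hub rewrite hub =
        trans (cong (bwd L) (sym (fwd-flipAt L T L-avoids-T (I β)))) (trans (bwd∘fwd L _) (flipAt-I β))
      flip-if-set false hub rewrite hub = bwd∘fwd L (I β)

  indicator-π : ∀ v b → indicator v (π b) ≡ indicator (π v) b
  indicator-π v b with ≡-decᵛ Bool._≟_ v (π b) | ≡-decᵛ Bool._≟_ (π v) b
  ... | yes _ | yes _ = refl
  ... | no _ | no _ = refl
  ... | yes v≡πb | no πv≢b = ⊥-elim (πv≢b (trans (cong π v≡πb) (π-involutive b)))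
  ... | no v≢πb | yes πv≡b = ⊥-elim (v≢πb (trans (sym (π-involutive v)) (cong π πv≡b)))

  ψ : State w
  ψ b = indicator (I false) b +ℤ - indicator (I true) b

  kickback : ∀ b → run (L ++ kick ∷ reverse L) ψ b ≡ sign g (ψ b)
  kickback b = begin
      run (L ++ kick ∷ reverse L) ψ b
    ≡⟨ trans (run≡∘bwd (L ++ kick ∷ reverse L) ψ b) (cong ψ (bwd-kickback b)) ⟩
      indicator (I false) (π b) +ℤ - indicator (I true) (π b)
    ≡⟨ cong₂ (λ x y → x +ℤ - y) (trans (indicator-π (I false) b) (cong (λ v → indicator v b) (π-I false)))
                                 (trans (indicator-π (I true) b) (cong (λ v → indicator v b) (π-I true))) ⟩
      indicator (if g then I true else I false) b +ℤ - indicator (if g then I false else I true) b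
    ≡⟨ swap-sign g ⟩
      sign g (ψ b)
    ∎
    where
      open ≡-Reasoning
      swap-sign : ∀ g → indicator (if g then I true else I false) b +ℤ - indicator (if g then I false else I true) b
                        ≡ sign g (ψ b)
      swap-sign false = refl
      swap-sign true = sym (trans (neg-distrib-+ (indicator (I false) b) _)
                             (trans (cong (- indicator (I false) b +ℤ_) (neg-involutive _))
                                    (+ℤ-comm (- indicator (I false) b) (indicator (I true) b))))

-- Routing every gate through a hub qubit

-- With the hub H in state 0, a gate on target t is replaced by: compute its control
-- condition into H, CNOT H t, clear H.  Every gate then touches H, so the dependency
-- DAG is a chain.  Gates already touching H are dropped; viaHubAll-correct excludes them.
module ViaHub {w : ℕ} (H : Fin w) where
  open Reversible {w}

  viaHub : Gate w → Circuit w
  viaHub (NOT t) with t ≟ᶠ H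
  ... | yes _ = []
  ... | no t≢H = NOT H ∷ CNOT H t (λ e → t≢H (sym e)) ∷ NOT H ∷ []
  viaHub (CNOT c t _) with c ≟ᶠ H | t ≟ᶠ H
  ... | no c≢H | no t≢H = CNOT c H c≢H ∷ CNOT H t (λ e → t≢H (sym e)) ∷ CNOT c H c≢H ∷ []
  ... | _ | _ = []
  viaHub (TOFFOLI a b t a≢b _ _) with a ≟ᶠ H | b ≟ᶠ H | t ≟ᶠ H
  ... | no a≢H | no b≢H | no t≢H =
    TOFFOLI a b H a≢b a≢H b≢H ∷ CNOT H t (λ e → t≢H (sym e)) ∷ TOFFOLI a b H a≢b a≢H b≢H ∷ []
  ... | _ | _ | _ = []

  viaHubAll : Circuit w → Circuit w
  viaHubAll [] = []
  viaHubAll (g ∷ C) = viaHub g ++ viaHubAll C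

  private
    flipAt-around : ∀ (s : Vec Bool w) t → flipAt H (flipAt t (flipAt H s)) ≡ flipAt t s
    flipAt-around s t = trans (cong (flipAt H) (flipAt-comm t H s)) (flipAt-involutive H (flipAt t s))

  viaHub-correct : ∀ g s → Avoids H g → lookup s H ≡ false → fwd (viaHub g) s ≡ basisAct g s
  viaHub-correct (NOT t) s (t≢H ∷ []) H₀ with t ≟ᶠ H
  ... | yes e = ⊥-elim (t≢H e)
  ... | no _ rewrite lookup∘updateAt H {not} s | H₀ = flipAt-around s t
  viaHub-correct (CNOT c t c≢t) s (c≢H ∷ t≢H ∷ []) H₀ with c ≟ᶠ H | t ≟ᶠ H
  ... | yes e | _ = ⊥-elim (c≢H e)
  ... | no _ | yes e = ⊥-elim (t≢H e)
  ... | no _ | no _ with lookup s c in ec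
  ... | false rewrite H₀ | ec = refl
  ... | true rewrite lookup∘updateAt H {not} s | H₀
                   | lookup-flipAt-other (flipAt H s) t c c≢t | lookup-flipAt-other s H c c≢H | ec = flipAt-around s t
  viaHub-correct (TOFFOLI a b t a≢b a≢t b≢t) s (a≢H ∷ b≢H ∷ t≢H ∷ []) H₀ with a ≟ᶠ H | b ≟ᶠ H | t ≟ᶠ H
  ... | yes e | _ | _ = ⊥-elim (a≢H e)
  ... | no _ | yes e | _ = ⊥-elim (b≢H e)
  ... | no _ | no _ | yes e = ⊥-elim (t≢H e)
  ... | no _ | no _ | no _ with lookup s a ∧ lookup s b in eab
  ... | false rewrite H₀ | eab = refl
  ... | true rewrite lookup∘updateAt H {not} s | H₀
                   | lookup-flipAt-other (flipAt H s) t a a≢t | lookup-flipAt-other s H a a≢H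
                   | lookup-flipAt-other (flipAt H s) t b b≢t | lookup-flipAt-other s H b b≢H | eab = flipAt-around s t

  viaHubAll-correct : ∀ C s → All (Avoids H) C → lookup s H ≡ false → fwd (viaHubAll C) s ≡ fwd C s
  viaHubAll-correct [] s [] H₀ = refl
  viaHubAll-correct (g ∷ C) s (avoid ∷ avoids) H₀ =
    trans (fwd-++ (viaHub g) (viaHubAll C) s)
      (trans (cong (fwd (viaHubAll C)) (viaHub-correct g s avoid H₀))
        (viaHubAll-correct C (basisAct g s) avoids (trans (lookup-basisAct g H avoid s) H₀)))

  viaHub-touches : ∀ g → All (λ g' → H ∈ wires g') (viaHub g)
  viaHub-touches (NOT t) with t ≟ᶠ H
  ... | yes _ = []
  ... | no _ = here refl ∷ here refl ∷ here refl ∷ []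
  viaHub-touches (CNOT c t _) with c ≟ᶠ H | t ≟ᶠ H
  ... | no _ | no _ = there (here refl) ∷ here refl ∷ there (here refl) ∷ []
  ... | yes _ | _ = []
  ... | no _ | yes _ = []
  viaHub-touches (TOFFOLI a b t _ _ _) with a ≟ᶠ H | b ≟ᶠ H | t ≟ᶠ H
  ... | no _ | no _ | no _ = there (there (here refl)) ∷ here refl ∷ there (there (here refl)) ∷ []
  ... | yes _ | _ | _ = []
  ... | no _ | yes _ | _ = []
  ... | no _ | no _ | yes _ = []

  viaHubAll-touches : ∀ C → All (λ g → H ∈ wires g) (viaHubAll C)
  viaHubAll-touches [] = []
  viaHubAll-touches (g ∷ C) = ++⁺ (viaHub-touches g) (viaHubAll-touches C)

  viaHub-avoids : ∀ g Q → Q ≢ H → Avoids Q g → All (Avoids Q) (viaHub g)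
  viaHub-avoids (NOT t) Q Q≢H (t≢Q ∷ []) with t ≟ᶠ H
  ... | yes _ = []
  ... | no _ = (H≢Q ∷ []) ∷ (H≢Q ∷ t≢Q ∷ []) ∷ (H≢Q ∷ []) ∷ []
    where H≢Q = λ e → Q≢H (sym e)
  viaHub-avoids (CNOT c t _) Q Q≢H (c≢Q ∷ t≢Q ∷ []) with c ≟ᶠ H | t ≟ᶠ H
  ... | no _ | no _ = (c≢Q ∷ H≢Q ∷ []) ∷ (H≢Q ∷ t≢Q ∷ []) ∷ (c≢Q ∷ H≢Q ∷ []) ∷ []
    where H≢Q = λ e → Q≢H (sym e)
  ... | yes _ | _ = []
  ... | no _ | yes _ = []
  viaHub-avoids (TOFFOLI a b t _ _ _) Q Q≢H (a≢Q ∷ b≢Q ∷ t≢Q ∷ []) with a ≟ᶠ H | b ≟ᶠ H | t ≟ᶠ H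
  ... | no _ | no _ | no _ = (a≢Q ∷ b≢Q ∷ H≢Q ∷ []) ∷ (H≢Q ∷ t≢Q ∷ []) ∷ (a≢Q ∷ b≢Q ∷ H≢Q ∷ []) ∷ []
    where H≢Q = λ e → Q≢H (sym e)
  ... | yes _ | _ | _ = []
  ... | no _ | yes _ | _ = []
  ... | no _ | no _ | yes _ = []

  viaHubAll-avoids : ∀ C Q → Q ≢ H → All (Avoids Q) C → All (Avoids Q) (viaHubAll C)
  viaHubAll-avoids [] Q Q≢H [] = []
  viaHubAll-avoids (g ∷ C) Q Q≢H (a ∷ as) = ++⁺ (viaHub-avoids g Q Q≢H a) (viaHubAll-avoids C Q Q≢H as)

  viaHub-length : ∀ g → length (viaHub g) ≤ 3
  viaHub-length (NOT t) with t ≟ᶠ H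
  ... | yes _ = z≤n
  ... | no _ = ≤-refl
  viaHub-length (CNOT c t _) with c ≟ᶠ H | t ≟ᶠ H
  ... | no _ | no _ = ≤-refl
  ... | yes _ | _ = z≤n
  ... | no _ | yes _ = z≤n
  viaHub-length (TOFFOLI a b t _ _ _) with a ≟ᶠ H | b ≟ᶠ H | t ≟ᶠ H
  ... | no _ | no _ | no _ = ≤-refl
  ... | yes _ | _ | _ = z≤n
  ... | no _ | yes _ | _ = z≤n
  ... | no _ | no _ | yes _ = z≤n

  viaHubAll-length : ∀ C → length (viaHubAll C) ≤ 3 * length C
  viaHubAll-length [] = z≤n
  viaHubAll-length (g ∷ C) = begin
      length (viaHub g ++ viaHubAll C)
    ≡⟨ length-++ (viaHub g) ⟩
      length (viaHub g) + length (viaHubAll C)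
    ≤⟨ +-mono-≤ (viaHub-length g) (viaHubAll-length C) ⟩
      3 + 3 * length C
    ≡⟨ sym (*-suc 3 (length C)) ⟩
      3 * suc (length C)
    ∎
    where open ≤-Reasoning

module _ {w : ℕ} (C : Circuit w) where

  path-length+start≤length : ∀ {i k len} → Path C i k len → len + toℕ i ≤ length C
  path-length+start≤length (here i) = toℕ<n i
  path-length+start≤length {i} (step {len = len} (i<j , _) p) =
    ≤-trans (≤-reflexive (sym (+-suc len (toℕ i)))) (≤-trans (+-monoʳ-≤ len i<j) (path-length+start≤length p))

  depth≤length : ∀ {D} → length C ≤ D → DepthAtMost C D
  depth≤length C≤D i k len p = ≤-trans (≤-trans (m≤m+n len (toℕ i)) (path-length+start≤length p)) C≤D

  width≤1 : (H : Fin w) → All (λ g → H ∈ wires g) C → WidthAtMost C 1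
  width≤1 H touches [] _ = z≤n
  width≤1 H touches (i ∷ []) _ = ≤-refl
  width≤1 H touches (i ∷ j ∷ A) (((i≢j , ¬i⇝j , ¬j⇝i) ∷ _) ∷ _) with <-cmp (toℕ i) (toℕ j)
  ... | tri< i<j _ _ = ⊥-elim (¬i⇝j 2 (step (i<j , H , touchesAt i , touchesAt j) (here j)))
    where touchesAt = λ k → All.lookup touches (∈-lookup k)
  ... | tri≈ _ i≡j _ = ⊥-elim (i≢j (toℕ-injective i≡j))
  ... | tri> _ _ j<i = ⊥-elim (¬j⇝i 2 (step (j<i , H , touchesAt j , touchesAt i) (here i)))
    where touchesAt = λ k → All.lookup touches (∈-lookup k)

-- Boolean formulas

Env : Set
Env = ℕ → Bool

data Formula : Set where
  var : ℕ → Formula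
  TT FF : Formula
  neg : Formula → Formula
  _⊕_ _&_ : Formula → Formula → Formula

⟦_⟧ : Formula → Env → Bool
⟦ var k ⟧ e = e k
⟦ TT ⟧ e = true
⟦ FF ⟧ e = false
⟦ neg F ⟧ e = not (⟦ F ⟧ e)
⟦ F ⊕ G ⟧ e = ⟦ F ⟧ e xor ⟦ G ⟧ e
⟦ F & G ⟧ e = ⟦ F ⟧ e ∧ ⟦ G ⟧ e

AllVars : (ℕ → Set) → Formula → Set
AllVars P (var k) = P k
AllVars P TT = ⊤
AllVars P FF = ⊤
AllVars P (neg F) = AllVars P F
AllVars P (F ⊕ G) = AllVars P F × AllVars P G
AllVars P (F & G) = AllVars P F × AllVars P G

AllVars-map : ∀ {P Q : ℕ → Set} → (∀ {k} → P k → Q k) → ∀ F → AllVars P F → AllVars Q F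
AllVars-map f (var k) a = f a
AllVars-map f TT a = tt
AllVars-map f FF a = tt
AllVars-map f (neg F) a = AllVars-map f F a
AllVars-map f (F ⊕ G) (a , b) = AllVars-map f F a , AllVars-map f G b
AllVars-map f (F & G) (a , b) = AllVars-map f F a , AllVars-map f G b

AllVars-zip : ∀ {P Q : ℕ → Set} F → AllVars P F → AllVars Q F → AllVars (λ k → P k × Q k) F
AllVars-zip (var k) a b = a , b
AllVars-zip TT a b = tt
AllVars-zip FF a b = tt
AllVars-zip (neg F) a b = AllVars-zip F a b
AllVars-zip (F ⊕ G) (a , a') (b , b') = AllVars-zip F a b , AllVars-zip G a' b'
AllVars-zip (F & G) (a , a') (b , b') = AllVars-zip F a b , AllVars-zip G a' b'

AllVars-<⇒≢ : ∀ F {p q} → p ≤ q → AllVars (_< p) F → AllVars (_≢ q) F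
AllVars-<⇒≢ F p≤q = AllVars-map (λ k<p k≡q → <⇒≢ (<-≤-trans k<p p≤q) k≡q) F

⟦⟧-cong : ∀ F {e e'} → AllVars (λ k → e k ≡ e' k) F → ⟦ F ⟧ e ≡ ⟦ F ⟧ e'
⟦⟧-cong (var k) a = a
⟦⟧-cong TT a = refl
⟦⟧-cong FF a = refl
⟦⟧-cong (neg F) a = cong not (⟦⟧-cong F a)
⟦⟧-cong (F ⊕ G) (a , b) = cong₂ _xor_ (⟦⟧-cong F a) (⟦⟧-cong G b)
⟦⟧-cong (F & G) (a , b) = cong₂ _∧_ (⟦⟧-cong F a) (⟦⟧-cong G b)

⟦⟧-cong-below : ∀ F {p e e'} → AllVars (_< p) F → (∀ k → k < p → e k ≡ e' k) → ⟦ F ⟧ e ≡ ⟦ F ⟧ e'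
⟦⟧-cong-below F vF h = ⟦⟧-cong F (AllVars-map (λ {k} k<p → h k k<p) F vF)

scratch : Formula → ℕ
scratch (var k) = 0
scratch TT = 0
scratch FF = 0
scratch (neg F) = scratch F
scratch (F ⊕ G) = scratch F ⊔ scratch G
scratch (F & G) = suc (suc (scratch F ⊔ scratch G))

cost : Formula → ℕ
cost (var k) = 1
cost TT = 1
cost FF = 0
cost (neg F) = cost F + 1
cost (F ⊕ G) = cost F + cost G
cost (F & G) = 2 * cost F + 2 * cost G + 1

Assignment : Set
Assignment = ℕ × Formula

xorEnv : ℕ → Bool → Env → Env
xorEnv t b e q with q ≟ t
... | yes _ = e q xor b
... | no _ = e q

xorEnv-same : ∀ t b e → xorEnv t b e t ≡ e t xor b
xorEnv-same t b e with t ≟ t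
... | yes _ = refl
... | no t≢t = ⊥-elim (t≢t refl)

xorEnv-other : ∀ t b e q → q ≢ t → xorEnv t b e q ≡ e q
xorEnv-other t b e q q≢t with q ≟ t
... | yes q≡t = ⊥-elim (q≢t q≡t)
... | no _ = refl

exec : List Assignment → Env → Env
exec [] e = e
exec ((t , F) ∷ prog) e = exec prog (xorEnv t (⟦ F ⟧ e) e)

exec-++ : ∀ prog prog' e q → exec (prog ++ prog') e q ≡ exec prog' (exec prog e) q
exec-++ [] prog' e q = refl
exec-++ ((t , F) ∷ prog) prog' e q = exec-++ prog prog' (xorEnv t (⟦ F ⟧ e) e) q

module Wires (W : ℕ) where
  open Reversible {suc W} public

  -- Qubits are addressed by natural numbers; addresses beyond W are clamped to qubit 0.
  wire : ℕ → Fin (suc W)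
  wire k with k ≤? W
  ... | yes k≤W = fromℕ< (s≤s k≤W)
  ... | no _ = fzero

  toℕ-wire : ∀ k → k ≤ W → toℕ (wire k) ≡ k
  toℕ-wire k k≤W with k ≤? W
  ... | yes p = toℕ-fromℕ< (s≤s p)
  ... | no ¬p = ⊥-elim (¬p k≤W)

  wire-injective : ∀ k l → k ≤ W → l ≤ W → wire k ≡ wire l → k ≡ l
  wire-injective k l k≤W l≤W e = trans (sym (toℕ-wire k k≤W)) (trans (cong toℕ e) (toℕ-wire l l≤W))

  nth-wire : ∀ s k → k ≤ W → lookup s (wire k) ≡ nth s k
  nth-wire s k k≤W = trans (lookup≡nth s (wire k)) (cong (nth s) (toℕ-wire k k≤W))

  wire-≢ : ∀ {k l} → k ≤ W → l ≤ W → k ≢ l → wire k ≢ wire l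
  wire-≢ k≤W l≤W k≢l e = k≢l (wire-injective _ _ k≤W l≤W e)

  xorAt : ℕ → Bool → Vec Bool (suc W) → Vec Bool (suc W)
  xorAt t b s = if b then flipAt (wire t) s else s

  nth-xorAt-same : ∀ t b s → t ≤ W → nth (xorAt t b s) t ≡ nth s t xor b
  nth-xorAt-same t true s t≤W with nth-flipAt-same s (wire t)
  ... | e rewrite toℕ-wire t t≤W = trans e (xor-comm true (nth s t))
  nth-xorAt-same t false s t≤W = sym (xor-identityʳ _)

  nth-xorAt-other : ∀ t b s q → t ≤ W → q ≢ t → nth (xorAt t b s) q ≡ nth s q
  nth-xorAt-other t true s q t≤W q≢t = nth-flipAt-other s (wire t) q (λ e → q≢t (trans e (toℕ-wire t t≤W)))
  nth-xorAt-other t false s q t≤W q≢t = refl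

  xorAt-involutive : ∀ t b s → xorAt t b (xorAt t b s) ≡ s
  xorAt-involutive t true s = flipAt-involutive (wire t) s
  xorAt-involutive t false s = refl

  xorAt-comm : ∀ k a l b s → xorAt k a (xorAt l b s) ≡ xorAt l b (xorAt k a s)
  xorAt-comm k true l true s = flipAt-comm (wire k) (wire l) s
  xorAt-comm k true l false s = refl
  xorAt-comm k false l true s = refl
  xorAt-comm k false l false s = refl

  xorAt-xorAt : ∀ t a b s → xorAt t b (xorAt t a s) ≡ xorAt t (a xor b) s
  xorAt-xorAt t true true s = flipAt-involutive (wire t) s
  xorAt-xorAt t true false s = refl
  xorAt-xorAt t false true s = refl
  xorAt-xorAt t false false s = refl

  xorAt-cancel-around : ∀ k a l c s → xorAt k a (xorAt l c (xorAt k a s)) ≡ xorAt l c s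
  xorAt-cancel-around k a l c s = trans (cong (xorAt k a) (xorAt-comm l c k a s)) (xorAt-involutive k a (xorAt l c s))

  ⟦⟧-xorAt-unread : ∀ F k c s → k ≤ W → AllVars (_≢ k) F → ⟦ F ⟧ (nth (xorAt k c s)) ≡ ⟦ F ⟧ (nth s)
  ⟦⟧-xorAt-unread F k c s k≤W vF = ⟦⟧-cong F (AllVars-map (λ {q} q≢k → nth-xorAt-other k c s q k≤W q≢k) F vF)

  notOn : ℕ → Circuit (suc W)
  notOn t = NOT (wire t) ∷ []

  -- The two-/three-qubit gates degenerate to the empty circuit on coinciding wires.
  cnotOn : ℕ → ℕ → Circuit (suc W)
  cnotOn c t with wire c ≟ᶠ wire t
  ... | yes _ = []
  ... | no c≢t = CNOT (wire c) (wire t) c≢t ∷ []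

  toffoliOn : ℕ → ℕ → ℕ → Circuit (suc W)
  toffoliOn a b t with wire a ≟ᶠ wire b | wire a ≟ᶠ wire t | wire b ≟ᶠ wire t
  ... | no a≢b | no a≢t | no b≢t = TOFFOLI (wire a) (wire b) (wire t) a≢b a≢t b≢t ∷ []
  ... | _ | _ | _ = []

  cnotOn-correct : ∀ {c t} s → c ≤ W → t ≤ W → c ≢ t → fwd (cnotOn c t) s ≡ xorAt t (nth s c) s
  cnotOn-correct {c} {t} s c≤W t≤W c≢t with wire c ≟ᶠ wire t
  ... | yes e = ⊥-elim (c≢t (wire-injective c t c≤W t≤W e))
  ... | no _ rewrite nth-wire s c c≤W = refl

  toffoliOn-correct : ∀ {a b t} s → a ≤ W → b ≤ W → t ≤ W → a ≢ b → a ≢ t → b ≢ t →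
                      fwd (toffoliOn a b t) s ≡ xorAt t (nth s a ∧ nth s b) s
  toffoliOn-correct {a} {b} {t} s a≤W b≤W t≤W a≢b a≢t b≢t with wire a ≟ᶠ wire b | wire a ≟ᶠ wire t | wire b ≟ᶠ wire t
  ... | yes e | _ | _ = ⊥-elim (a≢b (wire-injective a b a≤W b≤W e))
  ... | no _ | yes e | _ = ⊥-elim (a≢t (wire-injective a t a≤W t≤W e))
  ... | no _ | no _ | yes e = ⊥-elim (b≢t (wire-injective b t b≤W t≤W e))
  ... | no _ | no _ | no _ rewrite nth-wire s a a≤W | nth-wire s b b≤W = refl

  ClearOn : Vec Bool (suc W) → ℕ → ℕ → Set
  ClearOn s lo hi = ∀ q → lo ≤ q → q < hi → nth s q ≡ false

  ClearOn-⊆ : ∀ {s lo hi lo' hi'} → ClearOn s lo hi → lo ≤ lo' → hi' ≤ hi → ClearOn s lo' hi'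
  ClearOn-⊆ clear lo≤lo' hi'≤hi q lo'≤q q<hi' = clear q (≤-trans lo≤lo' lo'≤q) (<-≤-trans q<hi' hi'≤hi)

  ClearOn-xorAt : ∀ {s lo hi} t b → t < lo → t ≤ W → ClearOn s lo hi → ClearOn (xorAt t b s) lo hi
  ClearOn-xorAt {s} t b t<lo t≤W clear q lo≤q q<hi =
    trans (nth-xorAt-other t b s q t≤W (λ q≡t → <⇒≢ (<-≤-trans t<lo lo≤q) (sym q≡t))) (clear q lo≤q q<hi)

  -- Bennett's trick: F & G is computed into two fresh scratch qubits p and p+1,
  -- combined by a Toffoli into t, and both scratch qubits are uncomputed.
  compile : Formula → ℕ → ℕ → Circuit (suc W)
  compile (var k) t p = cnotOn k t
  compile TT t p = notOn t
  compile FF t p = []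
  compile (neg F) t p = compile F t p ++ notOn t
  compile (F ⊕ G) t p = compile F t p ++ compile G t p
  compile (F & G) t p =
    compile F p (2 + p) ++ (compile G (1 + p) (2 + p) ++
      (toffoliOn p (1 + p) t ++ (reverse (compile G (1 + p) (2 + p)) ++ reverse (compile F p (2 + p)))))

  XorsInto : Circuit (suc W) → ℕ → Formula → ℕ → Set
  XorsInto C t F p = ∀ s → ClearOn s p (p + scratch F) → fwd C s ≡ xorAt t (⟦ F ⟧ (nth s)) s

  XorsInto-bwd : ∀ {C t F p} → t < p → t ≤ W → AllVars (_≢ t) F → XorsInto C t F p →
                 ∀ s → ClearOn s p (p + scratch F) → bwd C s ≡ xorAt t (⟦ F ⟧ (nth s)) s
  XorsInto-bwd {C} {t} {F} t<p t≤W vF fwdC s clear = fwd≡⇒bwd≡ C (begin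
      fwd C v
    ≡⟨ fwdC v (ClearOn-xorAt t a t<p t≤W clear) ⟩
      xorAt t (⟦ F ⟧ (nth v)) v
    ≡⟨ cong (λ x → xorAt t x v) (⟦⟧-xorAt-unread F t a s t≤W vF) ⟩
      xorAt t a v
    ≡⟨ xorAt-involutive t a s ⟩
      s
    ∎)
    where
      open ≡-Reasoning
      a = ⟦ F ⟧ (nth s)
      v = xorAt t a s

  module Conjunction (F G : Formula) {t p : ℕ} (s : Vec Bool (suc W)) (t<p : t < p)
                     (bound : p + scratch (F & G) ≤ W) (clear : ClearOn s p (p + scratch (F & G))) where
    m = scratch F ⊔ scratch G
    scratch-& : p + scratch (F & G) ≡ 2 + p + m
    scratch-& = trans (+-suc p (suc m)) (cong suc (+-suc p m))
    1+p≤W : 1 + p ≤ W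
    1+p≤W = ≤-trans (n≤1+n (1 + p)) (≤-trans (m≤m+n (2 + p) m) (subst (_≤ W) scratch-& bound))
    p≤W = ≤-trans (n≤1+n p) 1+p≤W
    t≤W = ≤-trans (<⇒≤ t<p) p≤W
    p<2+p = n≤1+n (1 + p)
    a = ⟦ F ⟧ (nth s)
    b = ⟦ G ⟧ (nth s)
    s₁ = xorAt p a s
    s₂ = xorAt (1 + p) b s₁
    s₃ = xorAt t (a ∧ b) s₂
    s₄ = xorAt (1 + p) b s₃

    clear₀ : ClearOn s (2 + p) (2 + p + m)
    clear₀ = ClearOn-⊆ {s} clear (≤-trans (n≤1+n p) p<2+p) (≤-reflexive (sym scratch-&))
    clear₁ : ClearOn s₁ (2 + p) (2 + p + m)
    clear₁ = ClearOn-xorAt {s} p a p<2+p p≤W clear₀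
    clear₃ : ClearOn s₃ (2 + p) (2 + p + m)
    clear₃ = ClearOn-xorAt {s₂} t (a ∧ b) (<-trans t<p p<2+p) t≤W (ClearOn-xorAt {s₁} (1 + p) b ≤-refl 1+p≤W clear₁)
    clear₄ : ClearOn s₄ (2 + p) (2 + p + m)
    clear₄ = ClearOn-xorAt {s₃} (1 + p) b ≤-refl 1+p≤W clear₃

    Unchanged : Vec Bool (suc W) → Set
    Unchanged s' = ∀ q → q < p → q ≢ t → nth s' q ≡ nth s q
    unchanged-xorAt : ∀ {s'} k c → p ≤ k → k ≤ W → Unchanged s' → Unchanged (xorAt k c s')
    unchanged-xorAt {s'} k c p≤k k≤W u q q<p q≢t =
      trans (nth-xorAt-other k c s' q k≤W (λ q≡k → <⇒≢ (<-≤-trans q<p p≤k) q≡k)) (u q q<p q≢t)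
    unchanged₁ : Unchanged s₁
    unchanged₁ = unchanged-xorAt {s} p a ≤-refl p≤W (λ _ _ _ → refl)
    unchanged₃ : Unchanged s₃
    unchanged₃ q q<p q≢t = trans (nth-xorAt-other t (a ∧ b) s₂ q t≤W q≢t)
                                 (unchanged-xorAt {s₁} (1 + p) b (n≤1+n p) 1+p≤W unchanged₁ q q<p q≢t)
    unchanged₄ : Unchanged s₄
    unchanged₄ = unchanged-xorAt {s₃} (1 + p) b (n≤1+n p) 1+p≤W unchanged₃
    ⟦⟧-unchanged : ∀ H {s'} → AllVars (_< p) H → AllVars (_≢ t) H → Unchanged s' → ⟦ H ⟧ (nth s') ≡ ⟦ H ⟧ (nth s)
    ⟦⟧-unchanged H <pH ≢tH u = ⟦⟧-cong H (AllVars-map (λ (q<p , q≢t) → u _ q<p q≢t) H (AllVars-zip H <pH ≢tH))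

    s₂-p : nth s₂ p ≡ a
    s₂-p = trans (nth-xorAt-other (1 + p) b s₁ p 1+p≤W (<⇒≢ (n<1+n p)))
             (trans (nth-xorAt-same p a s p≤W) (cong (_xor a) (clear p ≤-refl (m<m+n p z<s))))
    s₂-1+p : nth s₂ (1 + p) ≡ b
    s₂-1+p = trans (nth-xorAt-same (1 + p) b s₁ 1+p≤W)
               (cong (_xor b) (trans (nth-xorAt-other p a s (1 + p) p≤W (λ e → <⇒≢ (n<1+n p) (sym e)))
                                    (clear (1 + p) (n≤1+n p) (≤-trans (m≤m+n (2 + p) m) (≤-reflexive (sym scratch-&))))))

  compile-&-correct : ∀ F G {t p} → AllVars (_< p) F → AllVars (_< p) G → AllVars (_≢ t) F → AllVars (_≢ t) G →
    t < p → p + scratch (F & G) ≤ W →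
    XorsInto (compile F p (2 + p)) p F (2 + p) → XorsInto (compile G (1 + p) (2 + p)) (1 + p) G (2 + p) →
    XorsInto (compile (F & G) t p) t (F & G) p
  compile-&-correct F G {t} {p} <pF <pG ≢tF ≢tG t<p bound xorsF xorsG s clear =
    begin
      fwd (compile (F & G) t p) s
    ≡⟨ fwd-conjugate A B (toffoliOn p (1 + p) t) step₁ step₂ step₃ step₄ step₅ ⟩
      xorAt p a (xorAt (1 + p) b (xorAt t (a ∧ b) (xorAt (1 + p) b s₁)))
    ≡⟨ cong (xorAt p a) (xorAt-cancel-around (1 + p) b t (a ∧ b) s₁) ⟩
      xorAt p a (xorAt t (a ∧ b) s₁)
    ≡⟨ xorAt-cancel-around p a t (a ∧ b) s ⟩
      xorAt t (a ∧ b) s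
    ∎
    where
      open ≡-Reasoning
      open Conjunction F G s t<p bound clear
      A = compile F p (2 + p)
      B = compile G (1 + p) (2 + p)
      clearF : ∀ {s'} → ClearOn s' (2 + p) (2 + p + m) → ClearOn s' (2 + p) (2 + p + scratch F)
      clearF {s'} c = ClearOn-⊆ {s'} c ≤-refl (+-monoʳ-≤ (2 + p) (m≤m⊔n (scratch F) (scratch G)))
      clearG : ∀ {s'} → ClearOn s' (2 + p) (2 + p + m) → ClearOn s' (2 + p) (2 + p + scratch G)
      clearG {s'} c = ClearOn-⊆ {s'} c ≤-refl (+-monoʳ-≤ (2 + p) (m≤n⊔m (scratch F) (scratch G)))

      step₁ : fwd A s ≡ s₁
      step₁ = xorsF s (clearF {s} clear₀)
      step₂ : fwd B s₁ ≡ s₂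
      step₂ = trans (xorsG s₁ (clearG {s₁} clear₁))
                    (cong (λ x → xorAt (1 + p) x s₁) (⟦⟧-unchanged G {s₁} <pG ≢tG unchanged₁))
      step₃ : fwd (toffoliOn p (1 + p) t) s₂ ≡ s₃
      step₃ = trans (toffoliOn-correct s₂ p≤W 1+p≤W t≤W (<⇒≢ (n<1+n p)) (λ e → <⇒≢ t<p (sym e))
                       (λ e → <⇒≢ (<-trans t<p (n<1+n p)) (sym e)))
                    (cong (λ x → xorAt t x s₂) (cong₂ _∧_ s₂-p s₂-1+p))
      step₄ : bwd B s₃ ≡ s₄
      step₄ = trans (XorsInto-bwd {B} {F = G} ≤-refl 1+p≤W (AllVars-<⇒≢ G (n≤1+n p) <pG) xorsG s₃ (clearG {s₃} clear₃))
                    (cong (λ x → xorAt (1 + p) x s₃) (⟦⟧-unchanged G {s₃} <pG ≢tG unchanged₃))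
      step₅ : bwd A s₄ ≡ xorAt p a s₄
      step₅ = trans (XorsInto-bwd {A} {F = F} p<2+p p≤W (AllVars-<⇒≢ F ≤-refl <pF) xorsF s₄ (clearF {s₄} clear₄))
                    (cong (λ x → xorAt p x s₄) (⟦⟧-unchanged F {s₄} <pF ≢tF unchanged₄))

  compile-correct : ∀ F {t p} → AllVars (_< p) F → AllVars (_≢ t) F → t < p → p + scratch F ≤ W →
                    XorsInto (compile F t p) t F p
  compile-correct (var k) {t} {p} k<p k≢t t<p bound s _ =
    cnotOn-correct s (≤-trans (<⇒≤ k<p) p≤W) (≤-trans (<⇒≤ t<p) p≤W) k≢t
    where p≤W = ≤-trans (m≤m+n p 0) bound
  compile-correct TT _ _ _ _ _ _ = refl
  compile-correct FF _ _ _ _ _ _ = refl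
  compile-correct (neg F) {t} {p} <p ≢t t<p bound s clear
    rewrite fwd-++ (compile F t p) (notOn t) s | compile-correct F <p ≢t t<p bound s clear with ⟦ F ⟧ (nth s)
  ... | true = flipAt-involutive (wire t) s
  ... | false = refl
  compile-correct (F ⊕ G) {t} {p} (<pF , <pG) (≢tF , ≢tG) t<p bound s clear =
    begin
      fwd (compile F t p ++ compile G t p) s
    ≡⟨ fwd-++ (compile F t p) (compile G t p) s ⟩
      fwd (compile G t p) (fwd (compile F t p) s)
    ≡⟨ cong (fwd (compile G t p)) (compile-correct F <pF ≢tF t<p (bound-≤ F≤) s (clear-≤ F≤)) ⟩
      fwd (compile G t p) s₁
    ≡⟨ compile-correct G <pG ≢tG t<p (bound-≤ G≤) s₁ (ClearOn-xorAt {s} t a t<p t≤W (clear-≤ G≤)) ⟩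
      xorAt t (⟦ G ⟧ (nth s₁)) s₁
    ≡⟨ cong (λ x → xorAt t x s₁) (⟦⟧-xorAt-unread G t a s t≤W ≢tG) ⟩
      xorAt t (⟦ G ⟧ (nth s)) s₁
    ≡⟨ xorAt-xorAt t a (⟦ G ⟧ (nth s)) s ⟩
      xorAt t (⟦ F ⊕ G ⟧ (nth s)) s
    ∎
    where
      open ≡-Reasoning
      a = ⟦ F ⟧ (nth s)
      s₁ = xorAt t a s
      t≤W = ≤-trans (<⇒≤ t<p) (≤-trans (m≤m+n p _) bound)
      F≤ = m≤m⊔n (scratch F) (scratch G)
      G≤ = m≤n⊔m (scratch F) (scratch G)
      bound-≤ : ∀ {k} → k ≤ scratch F ⊔ scratch G → p + k ≤ W
      bound-≤ k≤ = ≤-trans (+-monoʳ-≤ p k≤) bound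
      clear-≤ : ∀ {k} → k ≤ scratch F ⊔ scratch G → ClearOn s p (p + k)
      clear-≤ k≤ = ClearOn-⊆ {s} clear ≤-refl (+-monoʳ-≤ p k≤)
  compile-correct (F & G) {t} {p} (<pF , <pG) (≢tF , ≢tG) t<p bound =
    compile-&-correct F G <pF <pG ≢tF ≢tG t<p bound
      (compile-correct F (widen F <pF) (AllVars-<⇒≢ F ≤-refl <pF) p<2+p (bound-≤ (m≤m⊔n (scratch F) (scratch G))))
      (compile-correct G (widen G <pG) (AllVars-<⇒≢ G (n≤1+n p) <pG) ≤-refl (bound-≤ (m≤n⊔m (scratch F) (scratch G))))
    where
      p<2+p = n≤1+n (1 + p)
      widen : ∀ H → AllVars (_< p) H → AllVars (_< 2 + p) H
      widen H = AllVars-map (λ k<p → <-trans k<p p<2+p) H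
      bound-≤ : ∀ {k} → k ≤ scratch F ⊔ scratch G → 2 + p + k ≤ W
      bound-≤ k≤ = ≤-trans (+-monoʳ-≤ (2 + p) k≤)
                     (subst (_≤ W) (trans (+-suc p _) (cong suc (+-suc p _))) bound)

  compileProgram : ℕ → List Assignment → Circuit (suc W)
  compileProgram p [] = []
  compileProgram p ((t , F) ∷ prog) = compile F t p ++ compileProgram p prog

  Fits : ℕ → ℕ → Assignment → Set
  Fits p S (t , F) = t < p × AllVars (_< p) F × AllVars (_≢ t) F × scratch F ≤ S

  compileProgram-correct : ∀ p S prog s e → p + S ≤ W → All (Fits p S) prog → ClearOn s p (p + S) →
    (∀ q → q ≤ W → nth s q ≡ e q) → ∀ q → q ≤ W → nth (fwd (compileProgram p prog) s) q ≡ exec prog e q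
  compileProgram-correct p S [] s e bound [] clear s≈e q q≤W = s≈e q q≤W
  compileProgram-correct p S ((t , F) ∷ prog) s e bound ((t<p , <pF , ≢tF , F≤S) ∷ fits) clear s≈e q q≤W
    rewrite fwd-++ (compile F t p) (compileProgram p prog) s
          | compile-correct F <pF ≢tF t<p (≤-trans (+-monoʳ-≤ p F≤S) bound) s (ClearOn-⊆ {s} clear ≤-refl (+-monoʳ-≤ p F≤S)) =
    compileProgram-correct p S prog s₁ (xorEnv t (⟦ F ⟧ e) e) bound fits (ClearOn-xorAt {s} t v t<p t≤W clear) s₁≈e₁ q q≤W
    where
      t≤W = ≤-trans (<⇒≤ t<p) (≤-trans (m≤m+n p S) bound)
      v = ⟦ F ⟧ (nth s)
      s₁ = xorAt t v s
      v≡ : v ≡ ⟦ F ⟧ e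
      v≡ = ⟦⟧-cong-below F <pF (λ k k<p → s≈e k (≤-trans (<⇒≤ k<p) (≤-trans (m≤m+n p S) bound)))
      s₁≈e₁ : ∀ q → q ≤ W → nth s₁ q ≡ xorEnv t (⟦ F ⟧ e) e q
      s₁≈e₁ q q≤W with q ≟ t
      ... | yes refl = trans (nth-xorAt-same q v s t≤W) (cong₂ _xor_ (s≈e q q≤W) v≡)
      ... | no q≢t = trans (nth-xorAt-other t v s q t≤W q≢t) (s≈e q q≤W)

  UsesOnly : (Fin (suc W) → Set) → Circuit (suc W) → Set
  UsesOnly P C = All (λ g → All P (wires g)) C

  module _ (P : Fin (suc W) → Set) where

    cnotOn-uses : ∀ c t → P (wire c) → P (wire t) → UsesOnly P (cnotOn c t)
    cnotOn-uses c t pc pt with wire c ≟ᶠ wire t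
    ... | yes _ = []
    ... | no _ = (pc ∷ pt ∷ []) ∷ []

    toffoliOn-uses : ∀ a b t → P (wire a) → P (wire b) → P (wire t) → UsesOnly P (toffoliOn a b t)
    toffoliOn-uses a b t pa pb pt with wire a ≟ᶠ wire b | wire a ≟ᶠ wire t | wire b ≟ᶠ wire t
    ... | no _ | no _ | no _ = (pa ∷ pb ∷ pt ∷ []) ∷ []
    ... | yes _ | _ | _ = []
    ... | no _ | yes _ | _ = []
    ... | no _ | no _ | yes _ = []

    compile-uses : ∀ F t p → AllVars (P ∘ wire) F → P (wire t) → (∀ i → i < scratch F → P (wire (p + i))) →
                   UsesOnly P (compile F t p)
    compile-uses (var k) t p pF pt _ = cnotOn-uses k t pF pt
    compile-uses TT t p _ pt _ = (pt ∷ []) ∷ []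
    compile-uses FF t p _ _ _ = []
    compile-uses (neg F) t p pF pt ps = ++⁺ (compile-uses F t p pF pt ps) ((pt ∷ []) ∷ [])
    compile-uses (F ⊕ G) t p (pF , pG) pt ps =
      ++⁺ (compile-uses F t p pF pt (λ i i< → ps i (<-≤-trans i< (m≤m⊔n _ _))))
          (compile-uses G t p pG pt (λ i i< → ps i (<-≤-trans i< (m≤n⊔m _ _))))
    compile-uses (F & G) t p (pF , pG) pt ps =
      ++⁺ usesF (++⁺ usesG (++⁺ (toffoliOn-uses p (1 + p) t pp pp₁ pt) (++⁺ (All-reverse usesG) (All-reverse usesF))))
      where
        pp : P (wire p)
        pp = subst (P ∘ wire) (+-identityʳ p) (ps 0 z<s)
        pp₁ : P (wire (1 + p))
        pp₁ = subst (P ∘ wire) (trans (+-suc p 0) (cong suc (+-identityʳ p))) (ps 1 (s≤s z<s))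
        ps₂ : ∀ i → i < scratch F ⊔ scratch G → P (wire (2 + p + i))
        ps₂ i i< = subst (P ∘ wire) (trans (+-suc p (suc i)) (cong suc (+-suc p i))) (ps (2 + i) (s≤s (s≤s i<)))
        usesF = compile-uses F p (2 + p) pF pp (λ i i< → ps₂ i (<-≤-trans i< (m≤m⊔n _ _)))
        usesG = compile-uses G (1 + p) (2 + p) pG pp₁ (λ i i< → ps₂ i (<-≤-trans i< (m≤n⊔m _ _)))

    compileProgram-uses : ∀ p S prog →
      All (λ (a : Assignment) → AllVars (P ∘ wire) (proj₂ a) × P (wire (proj₁ a)) × scratch (proj₂ a) ≤ S) prog →
      (∀ i → i < S → P (wire (p + i))) → UsesOnly P (compileProgram p prog)
    compileProgram-uses p S [] [] _ = []
    compileProgram-uses p S ((t , F) ∷ prog) ((pF , pt , F≤S) ∷ ok) ps =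
      ++⁺ (compile-uses F t p pF pt (λ i i< → ps i (<-≤-trans i< F≤S))) (compileProgram-uses p S prog ok ps)

  cnotOn-length : ∀ c t → length (cnotOn c t) ≤ 1
  cnotOn-length c t with wire c ≟ᶠ wire t
  ... | yes _ = z≤n
  ... | no _ = ≤-refl

  toffoliOn-length : ∀ a b t → length (toffoliOn a b t) ≤ 1
  toffoliOn-length a b t with wire a ≟ᶠ wire b | wire a ≟ᶠ wire t | wire b ≟ᶠ wire t
  ... | no _ | no _ | no _ = ≤-refl
  ... | yes _ | _ | _ = z≤n
  ... | no _ | yes _ | _ = z≤n
  ... | no _ | no _ | yes _ = z≤n

  compile-length : ∀ F t p → length (compile F t p) ≤ cost F
  compile-length (var k) t p = cnotOn-length k t
  compile-length TT t p = ≤-refl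
  compile-length FF t p = ≤-refl
  compile-length (neg F) t p = ≤-trans (≤-reflexive (length-++ (compile F t p))) (+-monoˡ-≤ 1 (compile-length F t p))
  compile-length (F ⊕ G) t p =
    ≤-trans (≤-reflexive (length-++ (compile F t p))) (+-mono-≤ (compile-length F t p) (compile-length G t p))
  compile-length (F & G) t p = begin
      length (A ++ (B ++ (Tof ++ (reverse B ++ reverse A))))
    ≡⟨ lengths ⟩
      length A + (length B + (length Tof + (length B + length A)))
    ≤⟨ +-mono-≤ A≤ (+-mono-≤ B≤ (+-mono-≤ (toffoliOn-length p (1 + p) t) (+-mono-≤ B≤ A≤))) ⟩
      cost F + (cost G + (1 + (cost G + cost F)))
    ≡⟨ regroup (cost F) (cost G) ⟩
      2 * cost F + 2 * cost G + 1
    ∎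
    where
      open ≤-Reasoning
      A = compile F p (2 + p)
      B = compile G (1 + p) (2 + p)
      Tof = toffoliOn p (1 + p) t
      regroup : ∀ a b → a + (b + (1 + (b + a))) ≡ 2 * a + 2 * b + 1
      regroup = solve-∀
      A≤ = compile-length F p (2 + p)
      B≤ = compile-length G (1 + p) (2 + p)
      lengths : length (A ++ (B ++ (Tof ++ (reverse B ++ reverse A)))) ≡ length A + (length B + (length Tof + (length B + length A)))
      lengths rewrite length-++ A {B ++ (Tof ++ (reverse B ++ reverse A))} | length-++ B {Tof ++ (reverse B ++ reverse A)}
                    | length-++ Tof {reverse B ++ reverse A} | length-++ (reverse B) {reverse A}
                    | length-reverse A | length-reverse B = refl

  compileProgram-length : ∀ p K prog → All (λ (a : Assignment) → cost (proj₂ a) ≤ K) prog →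
                          length (compileProgram p prog) ≤ K * length prog
  compileProgram-length p K [] [] = z≤n
  compileProgram-length p K ((t , F) ∷ prog) (F≤K ∷ ok) = begin
      length (compile F t p ++ compileProgram p prog)
    ≡⟨ length-++ (compile F t p) ⟩
      length (compile F t p) + length (compileProgram p prog)
    ≤⟨ +-mono-≤ (≤-trans (compile-length F t p) F≤K) (compileProgram-length p K prog ok) ⟩
      K + K * length prog
    ≡⟨ sym (*-suc K (length prog)) ⟩
      K * suc (length prog)
    ∎
    where open ≤-Reasoning

-- A ripple-carry counter

bit : Bool → ℕ
bit false = 0
bit true = 1

bit≤1 : ∀ b → bit b ≤ 1
bit≤1 false = z≤n
bit≤1 true = ≤-refl

value : Env → ℕ → ℕ → ℕ
value e base zero = 0
value e base (suc j) = bit (e base) + 2 * value e (suc base) j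

value-cong : ∀ {e e'} base j → (∀ q → base ≤ q → q < base + j → e q ≡ e' q) → value e base j ≡ value e' base j
value-cong base zero _ = refl
value-cong base (suc j) agree =
  cong₂ (λ x y → bit x + 2 * y) (agree base ≤-refl (m<m+n base z<s))
    (value-cong (suc base) j (λ q base<q q< → agree q (<⇒≤ base<q) (<-≤-trans q< (≤-reflexive (sym (+-suc base j))))))

value<2^ : ∀ e base j → value e base j < 2 ^ j
value<2^ e base zero = z<s
value<2^ e base (suc j) = begin-strict
    bit (e base) + 2 * value e (suc base) j
  ≤⟨ +-monoˡ-≤ _ (bit≤1 (e base)) ⟩
    1 + 2 * value e (suc base) j
  <⟨ n<1+n _ ⟩
    2 + 2 * value e (suc base) j
  ≡⟨ sym (*-suc 2 (value e (suc base) j)) ⟩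
    2 * suc (value e (suc base) j)
  ≤⟨ *-monoʳ-≤ 2 (value<2^ e (suc base) j) ⟩
    2 * 2 ^ j
  ∎
  where open ≤-Reasoning

value-top : ∀ e base j → value e base (suc j) ≡ value e base j + 2 ^ j * bit (e (base + j))
value-top e base zero rewrite +-identityʳ base = trans (+-identityʳ _) (sym (+-identityʳ _))
value-top e base (suc j) =
  begin
    bit (e base) + 2 * value e (suc base) (suc j)
  ≡⟨ cong (λ x → bit (e base) + 2 * x) (value-top e (suc base) j) ⟩
    bit (e base) + 2 * (value e (suc base) j + 2 ^ j * bit (e (suc base + j)))
  ≡⟨ cong (λ x → bit (e base) + 2 * (value e (suc base) j + 2 ^ j * bit (e x))) (sym (+-suc base j)) ⟩
    bit (e base) + 2 * (value e (suc base) j + 2 ^ j * bit (e (base + suc j)))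
  ≡⟨ regroup (bit (e base)) (value e (suc base) j) (2 ^ j) (bit (e (base + suc j))) ⟩
    bit (e base) + 2 * value e (suc base) j + 2 * 2 ^ j * bit (e (base + suc j))
  ∎
  where
    open ≡-Reasoning
    regroup : ∀ b v p t → b + 2 * (v + p * t) ≡ b + 2 * v + 2 * p * t
    regroup = solve-∀

Clear : Env → ℕ → ℕ → Set
Clear e lo hi = ∀ q → lo ≤ q → q < hi → e q ≡ false

Outside : ℕ → ℕ → ℕ → Set
Outside lo hi q = q < lo ⊎ hi < q

Outside⇒≢lo : ∀ {lo hi q} → lo ≤ hi → Outside lo hi q → q ≢ lo
Outside⇒≢lo lo≤hi (inj₁ q<lo) = <⇒≢ q<lo
Outside⇒≢lo lo≤hi (inj₂ hi<q) q≡lo = <⇒≢ (≤-<-trans lo≤hi hi<q) (sym q≡lo)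

half-adder : ∀ x y V → bit (x xor y) + 2 * (V + bit (y ∧ x)) ≡ bit x + 2 * V + bit y
half-adder true true = solve-∀
half-adder true false = solve-∀
half-adder false true = solve-∀
half-adder false false = solve-∀

no-carry : ∀ V P → 2 * V < 2 * P → V + 0 < P
no-carry V P h = subst (_< P) (sym (+-identityʳ V)) (*-cancelˡ-< 2 V P h)

carry-bound : ∀ x y V P → bit x + 2 * V + bit y < 2 * P → V + bit (y ∧ x) < P
carry-bound true true V P h = *-cancelˡ-< 2 (V + 1) P (subst (_< 2 * P) (regroup V) h)
  where
    regroup : ∀ V → 1 + 2 * V + 1 ≡ 2 * (V + 1)
    regroup = solve-∀
carry-bound true false V P h = no-carry V P (≤-<-trans (m≤m+n (2 * V) 0) (≤-<-trans (n≤1+n _) h))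
carry-bound false true V P h = no-carry V P (≤-<-trans (m≤m+n (2 * V) 1) h)
carry-bound false false V P h = no-carry V P (≤-<-trans (m≤m+n (2 * V) 0) h)

xor-cancelʳ : ∀ x y → (x xor y) xor y ≡ x
xor-cancelʳ x y = trans (xor-assoc x y y) (trans (cong (x xor_) (xor-same y)) (xor-identityʳ x))

-- Adds the bit at position a to the (j+1)-bit counter at c, …, c + j;
-- positions a + 1, …, a + j hold the carries, which are cleared again.
increment : ℕ → ℕ → ℕ → List Assignment
increment zero c a = (c , var a) ∷ []
increment (suc j) c a =
  (suc a , var a & var c) ∷ (increment j (suc c) (suc a) ++ ((suc a , var a & var c) ∷ (c , var a) ∷ []))

module IncrementStep (j c a : ℕ) (e : Env) where
  e₁ = xorEnv (suc a) (e a ∧ e c) e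
  e₂ = exec (increment j (suc c) (suc a)) e₁
  e₃ = xorEnv (suc a) (e₂ a ∧ e₂ c) e₂
  e₄ = xorEnv c (e₃ a) e₃

  exec-increment-suc : ∀ q → exec (increment (suc j) c a) e q ≡ e₄ q
  exec-increment-suc = exec-++ (increment j (suc c) (suc a)) ((suc a , var a & var c) ∷ (c , var a) ∷ []) e₁

  module _ (c+j<a : c + suc j < a) where
    c+j<a' : suc c + j < suc a
    c+j<a' = <-trans (subst (_< a) (+-suc c j) c+j<a) (n<1+n a)
    c≢1+a : c ≢ suc a
    c≢1+a = <⇒≢ (≤-<-trans (m≤m+n c (suc j)) (<-trans c+j<a (n<1+n a)))
    Outside-shift : ∀ {q} → Outside c (c + suc j) q → Outside (suc c) (suc c + j) q
    Outside-shift (inj₁ q<c) = inj₁ (<-trans q<c (n<1+n c))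
    Outside-shift {q} (inj₂ c+j<q) = inj₂ (subst (_< q) (+-suc c j) c+j<q)

    module _ (frame₂ : ∀ q → Outside (suc c) (suc c + j) q → e₂ q ≡ e₁ q) where
      e₂a : e₂ a ≡ e a
      e₂a = trans (frame₂ a (inj₂ (subst (_< a) (+-suc c j) c+j<a))) (xorEnv-other (suc a) _ e a (<⇒≢ (n<1+n a)))
      e₂c : e₂ c ≡ e c
      e₂c = trans (frame₂ c (inj₁ (n<1+n c))) (xorEnv-other (suc a) _ e c c≢1+a)
      e₃a : e₃ a ≡ e a
      e₃a = trans (xorEnv-other (suc a) _ e₂ a (<⇒≢ (n<1+n a))) e₂a
      e₃c : e₃ c ≡ e c
      e₃c = trans (xorEnv-other (suc a) _ e₂ c c≢1+a) e₂c

increment-frame : ∀ j c a e → c + j < a → ∀ q → Outside c (c + j) q → exec (increment j c a) e q ≡ e q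
increment-frame zero c a e _ q out = xorEnv-other c _ e q (Outside⇒≢lo (m≤m+n c 0) out)
increment-frame (suc j) c a e c+j<a q out =
  trans (exec-increment-suc q) (trans (xorEnv-other c _ e₃ q (Outside⇒≢lo (m≤m+n c _) out)) (e₃-frame q out))
  where
    open IncrementStep j c a e
    frame₂ : ∀ q → Outside (suc c) (suc c + j) q → e₂ q ≡ e₁ q
    frame₂ = increment-frame j (suc c) (suc a) e₁ (c+j<a' c+j<a)
    e₃-frame : ∀ q → Outside c (c + suc j) q → e₃ q ≡ e q
    e₃-frame q out with q ≟ suc a
    ... | yes refl = begin
        e₂ (suc a) xor (e₂ a ∧ e₂ c)
      ≡⟨ cong₂ _xor_ (frame₂ (suc a) (inj₂ (c+j<a' c+j<a))) (cong₂ _∧_ (e₂a c+j<a frame₂) (e₂c c+j<a frame₂)) ⟩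
        e₁ (suc a) xor (e a ∧ e c)
      ≡⟨ cong (_xor (e a ∧ e c)) (xorEnv-same (suc a) (e a ∧ e c) e) ⟩
        (e (suc a) xor (e a ∧ e c)) xor (e a ∧ e c)
      ≡⟨ xor-cancelʳ (e (suc a)) (e a ∧ e c) ⟩
        e (suc a)
      ∎
      where open ≡-Reasoning
    ... | no q≢1+a = trans (frame₂ q (Outside-shift c+j<a out)) (xorEnv-other (suc a) _ e q q≢1+a)

increment-value : ∀ j c a e → c + j < a → Clear e (suc a) (suc a + j) →
  value e c (suc j) + bit (e a) < 2 ^ suc j →
  value (exec (increment j c a) e) c (suc j) ≡ value e c (suc j) + bit (e a)
increment-value zero c a e _ _ ov rewrite xorEnv-same c (e a) e = single-bit (e c) (e a) ov
  where
    single-bit : ∀ x y → bit x + 2 * 0 + bit y < 2 → bit (x xor y) + 2 * 0 ≡ bit x + 2 * 0 + bit y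
    single-bit true true (s≤s (s≤s ()))
    single-bit true false _ = refl
    single-bit false true _ = refl
    single-bit false false _ = refl
increment-value (suc j) c a e c+j<a clear ov = begin
    value (exec (increment (suc j) c a) e) c (2 + j)
  ≡⟨ value-cong c (2 + j) (λ q _ _ → exec-increment-suc q) ⟩
    bit (e₄ c) + 2 * value e₄ (suc c) (suc j)
  ≡⟨ cong₂ (λ x y → bit x + 2 * y) e₄c (trans (value-cong (suc c) (suc j) e₄≈e₂) IH) ⟩
    bit (e c xor e a) + 2 * (value e₁ (suc c) (suc j) + bit (e₁ (suc a)))
  ≡⟨ cong₂ (λ x y → bit (e c xor e a) + 2 * (x + bit y)) V₁ carry₁ ⟩
    bit (e c xor e a) + 2 * (V + bit (e a ∧ e c))
  ≡⟨ half-adder (e c) (e a) V ⟩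
    bit (e c) + 2 * V + bit (e a)
  ∎
  where
    open ≡-Reasoning
    open IncrementStep j c a e
    V = value e (suc c) (suc j)
    frame₂ = increment-frame j (suc c) (suc a) e₁ (c+j<a' c+j<a)
    top≤1+a : suc c + suc j ≤ suc a
    top≤1+a = ≤-trans c+j<a (n≤1+n a)
    carry₁ : e₁ (suc a) ≡ e a ∧ e c
    carry₁ = trans (xorEnv-same (suc a) _ e) (cong (_xor (e a ∧ e c)) (clear (suc a) ≤-refl (m<m+n (suc a) z<s)))
    V₁ : value e₁ (suc c) (suc j) ≡ V
    V₁ = value-cong (suc c) (suc j) (λ q _ q< → xorEnv-other (suc a) _ e q (<⇒≢ (<-≤-trans q< top≤1+a)))
    clear₁ : Clear e₁ (suc (suc a)) (suc (suc a) + j)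
    clear₁ q 2+a≤q q< = trans (xorEnv-other (suc a) _ e q (λ q≡ → <⇒≢ 2+a≤q (sym q≡)))
                              (clear q (≤-trans (n≤1+n (suc a)) 2+a≤q) (<-≤-trans q< (≤-reflexive (sym (+-suc (suc a) j)))))
    ov₁ : value e₁ (suc c) (suc j) + bit (e₁ (suc a)) < 2 ^ suc j
    ov₁ rewrite V₁ | carry₁ = carry-bound (e c) (e a) V (2 ^ suc j) ov
    IH = increment-value j (suc c) (suc a) e₁ (c+j<a' c+j<a) clear₁ ov₁
    e₄c : e₄ c ≡ e c xor e a
    e₄c = trans (xorEnv-same c (e₃ a) e₃) (cong₂ _xor_ (e₃c c+j<a frame₂) (e₃a c+j<a frame₂))
    e₄≈e₂ : ∀ q → suc c ≤ q → q < suc c + suc j → e₄ q ≡ e₂ q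
    e₄≈e₂ q c<q q< = trans (xorEnv-other c _ e₃ q (λ q≡c → <⇒≢ c<q (sym q≡c)))
                           (xorEnv-other (suc a) _ e₂ q (<⇒≢ (<-≤-trans q< top≤1+a)))

-- Adds the bit ⟦ Z ⟧ to the counter, staging it at position a.
addBit : ℕ → ℕ → ℕ → Formula → List Assignment
addBit j c a Z = (a , Z) ∷ (increment j c a ++ ((a , Z) ∷ []))

module AddBitStep (j c a : ℕ) (Z : Formula) (e : Env) where
  z = ⟦ Z ⟧ e
  e₁ = xorEnv a z e
  e₂ = exec (increment j c a) e₁

  exec-addBit : ∀ q → exec (addBit j c a Z) e q ≡ xorEnv a (⟦ Z ⟧ e₂) e₂ q
  exec-addBit = exec-++ (increment j c a) ((a , Z) ∷ []) e₁

  module _ (c+j<a : c + j < a) (Z<c : AllVars (_< c) Z) where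
    below-a : ∀ {q} → q < c + suc j → q ≢ a
    below-a q< = <⇒≢ (<-≤-trans q< (≤-trans (≤-reflexive (+-suc c j)) c+j<a))
    frame₂ : ∀ q → Outside c (c + j) q → e₂ q ≡ e₁ q
    frame₂ = increment-frame j c a e₁ c+j<a
    Z₂ : ⟦ Z ⟧ e₂ ≡ z
    Z₂ = ⟦⟧-cong-below Z Z<c λ k k<c →
      trans (frame₂ k (inj₁ k<c)) (xorEnv-other a z e k (below-a (<-≤-trans k<c (m≤m+n c _))))

addBit-frame : ∀ j c a Z e → c + j < a → AllVars (_< c) Z →
               ∀ q → Outside c (c + j) q → exec (addBit j c a Z) e q ≡ e q
addBit-frame j c a Z e c+j<a Z<c q out = trans (exec-addBit q) (restore q out)
  where
    open AddBitStep j c a Z e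
    restore : ∀ q → Outside c (c + j) q → xorEnv a (⟦ Z ⟧ e₂) e₂ q ≡ e q
    restore q out with q ≟ a
    ... | yes refl = trans (cong₂ _xor_ (trans (frame₂ c+j<a Z<c a (inj₂ c+j<a)) (xorEnv-same a z e)) (Z₂ c+j<a Z<c))
                           (xor-cancelʳ (e a) z)
    ... | no q≢a = trans (frame₂ c+j<a Z<c q out) (xorEnv-other a z e q q≢a)

addBit-value : ∀ j c a Z e → c + j < a → AllVars (_< c) Z → Clear e a (suc a + j) →
  value e c (suc j) + bit (⟦ Z ⟧ e) < 2 ^ suc j →
  value (exec (addBit j c a Z) e) c (suc j) ≡ value e c (suc j) + bit (⟦ Z ⟧ e)
addBit-value j c a Z e c+j<a Z<c clear ov = begin
    value (exec (addBit j c a Z) e) c (suc j)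
  ≡⟨ value-cong c (suc j) (λ q _ q< → trans (exec-addBit q) (xorEnv-other a _ e₂ q (below-a c+j<a Z<c q<))) ⟩
    value e₂ c (suc j)
  ≡⟨ increment-value j c a e₁ c+j<a clear₁ ov₁ ⟩
    value e₁ c (suc j) + bit (e₁ a)
  ≡⟨ cong₂ (λ x y → x + bit y) V₁ staged ⟩
    value e c (suc j) + bit z
  ∎
  where
    open ≡-Reasoning
    open AddBitStep j c a Z e
    staged : e₁ a ≡ z
    staged = trans (xorEnv-same a z e) (cong (_xor z) (clear a ≤-refl (s≤s (m≤m+n a j))))
    V₁ : value e₁ c (suc j) ≡ value e c (suc j)
    V₁ = value-cong c (suc j) (λ q _ q< → xorEnv-other a z e q (below-a c+j<a Z<c q<))
    clear₁ : Clear e₁ (suc a) (suc a + j)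
    clear₁ q a<q q< = trans (xorEnv-other a z e q (λ q≡a → <⇒≢ a<q (sym q≡a))) (clear q (<⇒≤ a<q) q<)
    ov₁ : value e₁ c (suc j) + bit (e₁ a) < 2 ^ suc j
    ov₁ rewrite V₁ | staged = ov

addBits : ℕ → ℕ → ℕ → List Formula → List Assignment
addBits j c a [] = []
addBits j c a (Z ∷ Zs) = addBit j c a Z ++ addBits j c a Zs

countTrue : Env → List Formula → ℕ
countTrue e [] = 0
countTrue e (Z ∷ Zs) = bit (⟦ Z ⟧ e) + countTrue e Zs

countTrue-cong-below : ∀ c Zs {e e'} → All (AllVars (_< c)) Zs → (∀ k → k < c → e k ≡ e' k) →
                       countTrue e Zs ≡ countTrue e' Zs
countTrue-cong-below c [] [] _ = refl
countTrue-cong-below c (Z ∷ Zs) (Z<c ∷ Zs<c) agree =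
  cong₂ _+_ (cong bit (⟦⟧-cong-below Z Z<c agree)) (countTrue-cong-below c Zs Zs<c agree)

addBits-frame : ∀ j c a Zs e → c + j < a → All (AllVars (_< c)) Zs →
                ∀ q → Outside c (c + j) q → exec (addBits j c a Zs) e q ≡ e q
addBits-frame j c a [] e _ [] q out = refl
addBits-frame j c a (Z ∷ Zs) e c+j<a (Z<c ∷ Zs<c) q out =
  trans (exec-++ (addBit j c a Z) (addBits j c a Zs) e q)
    (trans (addBits-frame j c a Zs _ c+j<a Zs<c q out) (addBit-frame j c a Z e c+j<a Z<c q out))

addBits-value : ∀ j c a Zs e → c + j < a → All (AllVars (_< c)) Zs → Clear e a (suc a + j) →
  value e c (suc j) + length Zs < 2 ^ suc j →
  value (exec (addBits j c a Zs) e) c (suc j) ≡ value e c (suc j) + countTrue e Zs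
addBits-value j c a [] e _ [] _ _ = sym (+-identityʳ _)
addBits-value j c a (Z ∷ Zs) e c+j<a (Z<c ∷ Zs<c) clear ov = begin
    value (exec (addBits j c a (Z ∷ Zs)) e) c (suc j)
  ≡⟨ value-cong c (suc j) (λ q _ _ → exec-++ (addBit j c a Z) (addBits j c a Zs) e q) ⟩
    value (exec (addBits j c a Zs) e₁) c (suc j)
  ≡⟨ addBits-value j c a Zs e₁ c+j<a Zs<c clear₁ ov₁ ⟩
    value e₁ c (suc j) + countTrue e₁ Zs
  ≡⟨ cong₂ _+_ V₁ (countTrue-cong-below c Zs Zs<c (λ k k<c → addBit-frame j c a Z e c+j<a Z<c k (inj₁ k<c))) ⟩
    value e c (suc j) + bit (⟦ Z ⟧ e) + countTrue e Zs
  ≡⟨ +-assoc (value e c (suc j)) _ _ ⟩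
    value e c (suc j) + countTrue e (Z ∷ Zs)
  ∎
  where
    open ≡-Reasoning
    e₁ = exec (addBit j c a Z) e
    ov₀ : value e c (suc j) + bit (⟦ Z ⟧ e) < 2 ^ suc j
    ov₀ = ≤-<-trans (+-monoʳ-≤ _ (≤-trans (bit≤1 _) (m≤m+n 1 (length Zs)))) ov
    V₁ : value e₁ c (suc j) ≡ value e c (suc j) + bit (⟦ Z ⟧ e)
    V₁ = addBit-value j c a Z e c+j<a Z<c clear ov₀
    clear₁ : Clear e₁ a (suc a + j)
    clear₁ q a≤q q< = trans (addBit-frame j c a Z e c+j<a Z<c q (inj₂ (<-≤-trans c+j<a a≤q))) (clear q a≤q q<)
    ov₁ : value e₁ c (suc j) + length Zs < 2 ^ suc j
    ov₁ rewrite V₁ = ≤-<-trans (≤-reflexive (+-assoc (value e c (suc j)) _ (length Zs)))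
                       (≤-<-trans (+-monoʳ-≤ (value e c (suc j)) (+-monoˡ-≤ (length Zs) (bit≤1 _))) ov)

lowBit : ℕ → Bool
lowBit zero = false
lowBit (suc zero) = true
lowBit (suc (suc k)) = lowBit k

lowBit+2*half : ∀ k → bit (lowBit k) + 2 * ⌊ k /2⌋ ≡ k
lowBit+2*half zero = refl
lowBit+2*half (suc zero) = refl
lowBit+2*half (suc (suc k)) = trans (regroup (bit (lowBit k)) ⌊ k /2⌋) (cong (λ x → suc (suc x)) (lowBit+2*half k))
  where
    regroup : ∀ b h → b + 2 * suc h ≡ suc (suc (b + 2 * h))
    regroup = solve-∀

setBit : Bool → ℕ → List Assignment
setBit b q = if b then (q , TT) ∷ [] else []

setBit-same : ∀ b q e → exec (setBit b q) e q ≡ e q xor b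
setBit-same true q e = xorEnv-same q true e
setBit-same false q e = sym (xor-identityʳ (e q))

setBit-other : ∀ b q e q' → q' ≢ q → exec (setBit b q) e q' ≡ e q'
setBit-other true q e q' q'≢q = xorEnv-other q true e q' q'≢q
setBit-other false q e q' q'≢q = refl

setConstant : ℕ → ℕ → ℕ → List Assignment
setConstant K base zero = []
setConstant K base (suc j) = setBit (lowBit K) base ++ setConstant ⌊ K /2⌋ (suc base) j

setConstant-correct : ∀ j K base e → Clear e base (base + j) → K < 2 ^ j →
  value (exec (setConstant K base j) e) base j ≡ K
  × (∀ q → q < base ⊎ base + j ≤ q → exec (setConstant K base j) e q ≡ e q)
setConstant-correct zero zero base e _ _ = refl , λ _ _ → refl
setConstant-correct zero (suc K) base e _ (s≤s ())
setConstant-correct (suc j) K base e clear K< = value-K , frame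
  where
    e₁ = exec (setBit (lowBit K) base) e
    E = exec (setConstant K base (suc j)) e
    E≡ : ∀ q → E q ≡ exec (setConstant ⌊ K /2⌋ (suc base) j) e₁ q
    E≡ = exec-++ (setBit (lowBit K) base) (setConstant ⌊ K /2⌋ (suc base) j) e
    shift : suc base + j ≡ base + suc j
    shift = sym (+-suc base j)
    clear₁ : Clear e₁ (suc base) (suc base + j)
    clear₁ q base<q q< = trans (setBit-other (lowBit K) base e q (λ q≡ → <⇒≢ base<q (sym q≡)))
                               (clear q (<⇒≤ base<q) (subst (q <_) shift q<))
    half< : ⌊ K /2⌋ < 2 ^ j
    half< = *-cancelˡ-< 2 ⌊ K /2⌋ (2 ^ j)
              (≤-<-trans (m≤n+m (2 * ⌊ K /2⌋) (bit (lowBit K))) (subst (_< 2 ^ suc j) (sym (lowBit+2*half K)) K<))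
    IH = setConstant-correct j ⌊ K /2⌋ (suc base) e₁ clear₁ half<
    E-base : E base ≡ lowBit K
    E-base = trans (E≡ base) (trans (proj₂ IH base (inj₁ (n<1+n base)))
               (trans (setBit-same (lowBit K) base e) (cong (_xor lowBit K) (clear base ≤-refl (m<m+n base z<s)))))
    value-K : value E base (suc j) ≡ K
    value-K = trans (cong₂ (λ x y → bit x + 2 * y) E-base (trans (value-cong (suc base) j (λ q _ _ → E≡ q)) (proj₁ IH)))
                    (lowBit+2*half K)
    frame : ∀ q → q < base ⊎ base + suc j ≤ q → E q ≡ e q
    frame q (inj₁ q<base) = trans (E≡ q) (trans (proj₂ IH q (inj₁ (<-trans q<base (n<1+n base))))
                                                (setBit-other (lowBit K) base e q (<⇒≢ q<base)))
    frame q (inj₂ top≤q) = trans (E≡ q) (trans (proj₂ IH q (inj₂ (subst (_≤ q) (sym shift) top≤q)))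
                             (setBit-other (lowBit K) base e q (λ q≡ → <⇒≢ (<-≤-trans (m<m+n base z<s) top≤q) (sym q≡))))

<ᵇ≡true : ∀ {m n} → m < n → (m <ᵇ n) ≡ true
<ᵇ≡true m<n = Equivalence.to T-≡ (<⇒<ᵇ m<n)

<ᵇ≡false : ∀ {m n} → n ≤ m → (m <ᵇ n) ≡ false
<ᵇ≡false {m} {n} n≤m with m <ᵇ n in eq
... | false = refl
... | true = ⊥-elim (<⇒≱ (<ᵇ⇒< m n (subst T (sym eq) tt)) n≤m)

value<ᵇ2^ : ∀ e c j → (value e c (suc j) <ᵇ 2 ^ j) ≡ not (e (c + j))
value<ᵇ2^ e c j rewrite value-top e c j with e (c + j)
... | true = <ᵇ≡false (≤-trans (≤-reflexive (sym (*-identityʳ (2 ^ j)))) (m≤n+m (2 ^ j * 1) (value e c j)))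
... | false = <ᵇ≡true (subst (_< 2 ^ j) (sym (trans (cong (value e c j +_) (*-zeroʳ (2 ^ j))) (+-identityʳ _))) (value<2^ e c j))

countingProgram : (j c a r K : ℕ) → List Formula → Formula → List Assignment
countingProgram j c a r K Zs G = setConstant K c (suc j) ++ (addBits j c a Zs ++ ((r , G & neg (var (c + j))) ∷ []))

countingProgram-correct : ∀ j c a r K Zs G e → r < c → c + j < a → e r ≡ false →
  Clear e c (c + suc j) → Clear e a (suc a + j) → All (AllVars (_< c)) Zs → AllVars (_< c) G → AllVars (_≢ r) G →
  K + length Zs < 2 ^ suc j →
  exec (countingProgram j c a r K Zs G) e r ≡ ⟦ G ⟧ e ∧ (K + countTrue e Zs <ᵇ 2 ^ j)
  × (∀ q → q < c → q ≢ r → exec (countingProgram j c a r K Zs G) e q ≡ e q)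
countingProgram-correct j c a r K Zs G e r<c c+j<a r₀ counter₀ carries₀ Zs<c G<c G≢r ov = result , frame
  where
    init = setConstant-correct (suc j) K c e counter₀ (≤-<-trans (m≤m+n K _) ov)
    e₁ = exec (setConstant K c (suc j)) e
    e₂ = exec (addBits j c a Zs) e₁
    E≡ : ∀ q → exec (countingProgram j c a r K Zs G) e q ≡ exec ((r , G & neg (var (c + j))) ∷ []) e₂ q
    E≡ q = trans (exec-++ (setConstant K c (suc j)) _ e q) (exec-++ (addBits j c a Zs) _ e₁ q)
    carries₁ : Clear e₁ a (suc a + j)
    carries₁ q a≤q q< =
      trans (proj₂ init q (inj₂ (≤-trans (≤-reflexive (+-suc c j)) (<-≤-trans c+j<a a≤q)))) (carries₀ q a≤q q<)
    below : ∀ q → q < c → e₂ q ≡ e q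
    below q q<c = trans (addBits-frame j c a Zs e₁ c+j<a Zs<c q (inj₁ q<c)) (proj₂ init q (inj₁ q<c))
    count₂ : value e₂ c (suc j) ≡ K + countTrue e Zs
    count₂ = trans (addBits-value j c a Zs e₁ c+j<a Zs<c carries₁ (subst (λ x → x + length Zs < 2 ^ suc j) (sym (proj₁ init)) ov))
                   (cong₂ _+_ (proj₁ init) (countTrue-cong-below c Zs Zs<c (λ k k<c → proj₂ init k (inj₁ k<c))))
    result : exec (countingProgram j c a r K Zs G) e r ≡ ⟦ G ⟧ e ∧ (K + countTrue e Zs <ᵇ 2 ^ j)
    result = trans (E≡ r) (trans (xorEnv-same r _ e₂)
      (trans (cong (_xor (⟦ G ⟧ e₂ ∧ not (e₂ (c + j)))) (trans (below r r<c) r₀))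
               (cong₂ _∧_ (⟦⟧-cong-below G G<c below)
                          (trans (sym (value<ᵇ2^ e₂ c j)) (cong (_<ᵇ 2 ^ j) count₂)))))
    frame : ∀ q → q < c → q ≢ r → exec (countingProgram j c a r K Zs G) e q ≡ e q
    frame q q<c q≢r = trans (E≡ q) (trans (xorEnv-other r _ e₂ q q≢r) (below q q<c))

increment-All : ∀ {P : Assignment → Set} j c a →
  (∀ i → i < j → P (suc (a + i) , var (a + i) & var (c + i))) → (∀ i → i ≤ j → P (c + i , var (a + i))) →
  All P (increment j c a)
increment-All {P} zero c a _ P-add = subst P (cong₂ (λ x y → x , var y) (+-identityʳ c) (+-identityʳ a)) (P-add 0 z≤n) ∷ []
increment-All {P} (suc j) c a P-carry P-add =
  carry ∷ ++⁺ (increment-All j (suc c) (suc a) P-carry' P-add')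
              (carry ∷ subst P (cong₂ (λ x y → x , var y) (+-identityʳ c) (+-identityʳ a)) (P-add 0 z≤n) ∷ [])
  where
    carry : P (suc a , var a & var c)
    carry = subst P (cong₂ (λ x y → suc x , var x & var y) (+-identityʳ a) (+-identityʳ c)) (P-carry 0 z<s)
    P-carry' : ∀ i → i < j → P (suc (suc a + i) , var (suc a + i) & var (suc c + i))
    P-carry' i i<j = subst P (cong₂ (λ x y → suc x , var x & var y) (+-suc a i) (+-suc c i)) (P-carry (suc i) (s≤s i<j))
    P-add' : ∀ i → i ≤ j → P (suc c + i , var (suc a + i))
    P-add' i i≤j = subst P (cong₂ (λ x y → x , var y) (+-suc c i) (+-suc a i)) (P-add (suc i) (s≤s i≤j))

setConstant-All : ∀ {P : Assignment → Set} K base j → (∀ i → i < j → P (base + i , TT)) → All P (setConstant K base j)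
setConstant-All K base zero _ = []
setConstant-All {P} K base (suc j) P-set =
  ++⁺ setBit-All (setConstant-All ⌊ K /2⌋ (suc base) j (λ i i<j → subst P (cong (_, TT) (+-suc base i)) (P-set (suc i) (s≤s i<j))))
  where
    setBit-All : All P (setBit (lowBit K) base)
    setBit-All with lowBit K
    ... | true = subst P (cong (_, TT) (+-identityʳ base)) (P-set 0 z<s) ∷ []
    ... | false = []

addBits-All : ∀ {P : Assignment → Set} j c a Zs → All (λ Z → P (a , Z)) Zs → All P (increment j c a) → All P (addBits j c a Zs)
addBits-All j c a [] [] _ = []
addBits-All j c a (Z ∷ Zs) (PZ ∷ PZs) P-inc = ++⁺ (PZ ∷ ++⁺ P-inc (PZ ∷ [])) (addBits-All j c a Zs PZs P-inc)

length-setConstant : ∀ K base j → length (setConstant K base j) ≤ j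
length-setConstant K base zero = z≤n
length-setConstant K base (suc j) =
  ≤-trans (≤-reflexive (length-++ (setBit (lowBit K) base)))
          (+-mono-≤ (length-setBit (lowBit K)) (length-setConstant ⌊ K /2⌋ (suc base) j))
  where
    length-setBit : ∀ b → length (setBit b base) ≤ 1
    length-setBit true = ≤-refl
    length-setBit false = z≤n

length-increment : ∀ j c a → length (increment j c a) ≡ 3 * j + 1
length-increment zero c a = refl
length-increment (suc j) c a =
  trans (cong suc (trans (length-++ (increment j (suc c) (suc a))) (cong (_+ 2) (length-increment j (suc c) (suc a))))) (regroup j)
  where
    regroup : ∀ j → suc (3 * j + 1 + 2) ≡ 3 * suc j + 1
    regroup = solve-∀

length-addBits : ∀ j c a Zs → length (addBits j c a Zs) ≡ length Zs * (3 * j + 3)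
length-addBits j c a [] = refl
length-addBits j c a (Z ∷ Zs) = begin
    length (addBit j c a Z ++ addBits j c a Zs)
  ≡⟨ length-++ (addBit j c a Z) ⟩
    suc (length (increment j c a ++ (a , Z) ∷ [])) + length (addBits j c a Zs)
  ≡⟨ cong₂ (λ x y → suc x + y) (trans (length-++ (increment j c a)) (cong (_+ 1) (length-increment j c a)))
                               (length-addBits j c a Zs) ⟩
    suc (3 * j + 1 + 1) + length Zs * (3 * j + 3)
  ≡⟨ regroup j (length Zs) ⟩
    suc (length Zs) * (3 * j + 3)
  ∎
  where
    open ≡-Reasoning
    regroup : ∀ j z → suc (3 * j + 1 + 1) + z * (3 * j + 3) ≡ suc z * (3 * j + 3)
    regroup = solve-∀

-- Crossing formulas

module Crossings (n : ℕ) where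

  Edge : Set
  Edge = Fin n × Fin n

  open import Data.List.Membership.DecPropositional (≡-decˣ (_≟ᶠ_ {n}) (_≟ᶠ_ {n})) using (_∈?_)

  pair∈pairs : ∀ u v → toℕ u < toℕ v → (u , v) ∈ pairs n
  pair∈pairs u v u<v =
    ∈-concatMap⁺ (λ i → map (λ j → (i , j)) (filterᵇ (λ j → toℕ i <ᵇ toℕ j) (allFin n)))
      (Any.map (λ { refl → ∈-map⁺ (λ j → (u , j))
                             (∈-filter⁺ (λ j → T? (toℕ u <ᵇ toℕ j)) (∈-allFin v) (<⇒<ᵇ u<v)) })
               (∈-allFin u))

  -- Qubit 0 holds f(φ), so x_{u,v} sits at 1 + its index in  pairs n  (junk 0 for non-pairs).
  xIndex : Fin n → Fin n → ℕ
  xIndex u v with (u , v) ∈? pairs n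
  ... | yes uv∈ = suc (toℕ (index uv∈))
  ... | no _ = 0

  xIndex< : ∀ u v → xIndex u v < suc (numPairs n)
  xIndex< u v with (u , v) ∈? pairs n
  ... | yes uv∈ = s≤s (toℕ<n (index uv∈))
  ... | no _ = s≤s z≤n

  HoldsX : Phi n → Env → Set
  HoldsX φ e = ∀ u v → toℕ u < toℕ v → e (xIndex u v) ≡ xbit φ u v

  nth-xVec : ∀ (φ : Phi n) u v (uv∈ : (u , v) ∈ pairs n) → nth (xVec φ) (toℕ (index uv∈)) ≡ xbit φ u v
  nth-xVec φ u v uv∈ = begin
      nth (xVec φ) (toℕ (index uv∈))
    ≡⟨ sym (lookup≡nth (xVec φ) (index uv∈)) ⟩
      lookup (Vec.map (λ p → xbit φ (proj₁ p) (proj₂ p)) (fromList (pairs n))) (index uv∈)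
    ≡⟨ lookup-map (index uv∈) _ (fromList (pairs n)) ⟩
      xbitOf (lookup (fromList (pairs n)) (index uv∈))
    ≡⟨ cong xbitOf (lookup-fromList (pairs n) (index uv∈)) ⟩
      xbitOf (List.lookup (pairs n) (index uv∈))
    ≡⟨ cong xbitOf (sym (lookup-index uv∈)) ⟩
      xbit φ u v
    ∎
    where
      open ≡-Reasoning
      xbitOf : Edge → Bool
      xbitOf p = xbit φ (proj₁ p) (proj₂ p)

  holdsX : ∀ (φ : Phi n) e → (∀ k → k < numPairs n → e (suc k) ≡ nth (xVec φ) k) → HoldsX φ e
  holdsX φ e e≈x u v u<v with (u , v) ∈? pairs n
  ... | yes uv∈ = trans (e≈x (toℕ (index uv∈)) (toℕ<n (index uv∈))) (nth-xVec φ u v uv∈)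
  ... | no uv∉ = ⊥-elim (uv∉ (pair∈pairs u v u<v))

  precedesF : Fin n → Fin n → Formula
  precedesF u v =
    if toℕ u <ᵇ toℕ v then var (xIndex u v) else (if toℕ v <ᵇ toℕ u then neg (var (xIndex v u)) else FF)

  ⟦precedesF⟧ : ∀ φ e → HoldsX φ e → ∀ u v → ⟦ precedesF u v ⟧ e ≡ precedes φ u v
  ⟦precedesF⟧ φ e x u v with toℕ u <ᵇ toℕ v in u<v
  ... | true = x u v (<ᵇ⇒< _ _ (Equivalence.from T-≡ u<v))
  ... | false with toℕ v <ᵇ toℕ u in v<u
  ... | true = cong not (x v u (<ᵇ⇒< _ _ (Equivalence.from T-≡ v<u)))
  ... | false = refl

  _orF_ : Formula → Formula → Formula
  F orF G = neg (neg F & neg G)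

  betweenF : Fin n → Fin n → Fin n → Formula
  betweenF c a b = (precedesF a c & precedesF c b) orF (precedesF b c & precedesF c a)

  ⟦betweenF⟧ : ∀ φ e → HoldsX φ e → ∀ c a b → ⟦ betweenF c a b ⟧ e ≡ between φ c a b
  ⟦betweenF⟧ φ e x c a b
    rewrite ⟦precedesF⟧ φ e x a c | ⟦precedesF⟧ φ e x c b | ⟦precedesF⟧ φ e x b c | ⟦precedesF⟧ φ e x c a =
    de-morgan (precedes φ a c ∧ precedes φ c b) (precedes φ b c ∧ precedes φ c a)
    where
      de-morgan : ∀ x y → not (not x ∧ not y) ≡ x ∨ y
      de-morgan true y = refl
      de-morgan false y = not-involutive y

  crossesF : Edge → Edge → Formula
  crossesF (a , b) (c , d) =
    if not (a == c ∨ a == d ∨ b == c ∨ b == d) then betweenF c a b ⊕ betweenF d a b else FF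

  ⟦crossesF⟧ : ∀ φ e → HoldsX φ e → ∀ f f' → ⟦ crossesF f f' ⟧ e ≡ crosses φ f f'
  ⟦crossesF⟧ φ e x (a , b) (c , d) with not (a == c ∨ a == d ∨ b == c ∨ b == d)
  ... | true = cong₂ _xor_ (⟦betweenF⟧ φ e x c a b) (⟦betweenF⟧ φ e x d a b)
  ... | false = refl

  crossingFormulas : List Edge → List Formula
  crossingFormulas [] = []
  crossingFormulas (f ∷ fs) = map (crossesF f) fs ++ crossingFormulas fs

  pairCount : List Edge → ℕ
  pairCount [] = 0
  pairCount (f ∷ fs) = length fs + pairCount fs

  length-crossingFormulas : ∀ fs → length (crossingFormulas fs) ≡ pairCount fs
  length-crossingFormulas [] = refl
  length-crossingFormulas (f ∷ fs) =
    trans (length-++ (map (crossesF f) fs)) (cong₂ _+_ (length-map (crossesF f) fs) (length-crossingFormulas fs))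

  countTrue-++ : ∀ e Zs Zs' → countTrue e (Zs ++ Zs') ≡ countTrue e Zs + countTrue e Zs'
  countTrue-++ e [] Zs' = refl
  countTrue-++ e (Z ∷ Zs) Zs' = trans (cong (bit (⟦ Z ⟧ e) +_) (countTrue-++ e Zs Zs')) (sym (+-assoc (bit (⟦ Z ⟧ e)) _ _))

  countTrue-crossingFormulas : ∀ φ e → HoldsX φ e → ∀ fs → countTrue e (crossingFormulas fs) ≡ crossCount φ fs
  countTrue-crossingFormulas φ e x [] = refl
  countTrue-crossingFormulas φ e x (f ∷ fs) =
    trans (countTrue-++ e (map (crossesF f) fs) (crossingFormulas fs))
          (cong₂ _+_ (countTrue-map fs) (countTrue-crossingFormulas φ e x fs))
    where
      countTrue-map : ∀ fs → countTrue e (map (crossesF f) fs) ≡ length (filterᵇ (crosses φ f) fs)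
      countTrue-map [] = refl
      countTrue-map (f' ∷ fs) rewrite ⟦crossesF⟧ φ e x f f' with crosses φ f f'
      ... | true = cong suc (countTrue-map fs)
      ... | false = countTrue-map fs

  crossCount≤pairCount : ∀ φ fs → crossCount φ fs ≤ pairCount fs
  crossCount≤pairCount φ [] = z≤n
  crossCount≤pairCount φ (f ∷ fs) = +-mono-≤ (length-filter (T? ∘ crosses φ f) fs) (crossCount≤pairCount φ fs)

  precedesF-vars : ∀ {P : ℕ → Set} → (∀ u v → P (xIndex u v)) → ∀ u v → AllVars P (precedesF u v)
  precedesF-vars P-x u v with toℕ u <ᵇ toℕ v
  ... | true = P-x u v
  ... | false with toℕ v <ᵇ toℕ u
  ... | true = P-x v u
  ... | false = tt

  crossesF-vars : ∀ {P : ℕ → Set} → (∀ u v → P (xIndex u v)) → ∀ f f' → AllVars P (crossesF f f')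
  crossesF-vars P-x (a , b) (c , d) with not (a == c ∨ a == d ∨ b == c ∨ b == d)
  ... | true = ((pv a c , pv c b) , (pv b c , pv c a)) , ((pv a d , pv d b) , (pv b d , pv d a))
    where pv = precedesF-vars P-x
  ... | false = tt

  scratch-precedesF : ∀ u v → scratch (precedesF u v) ≡ 0
  scratch-precedesF u v with toℕ u <ᵇ toℕ v
  ... | true = refl
  ... | false with toℕ v <ᵇ toℕ u
  ... | true = refl
  ... | false = refl

  cost-precedesF : ∀ u v → cost (precedesF u v) ≤ 2
  cost-precedesF u v with toℕ u <ᵇ toℕ v
  ... | true = s≤s z≤n
  ... | false with toℕ v <ᵇ toℕ u
  ... | true = ≤-refl
  ... | false = z≤n

  scratch-betweenF : ∀ c a b → scratch (betweenF c a b) ≡ 4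
  scratch-betweenF c a b rewrite scratch-precedesF a c | scratch-precedesF c b | scratch-precedesF b c | scratch-precedesF c a = refl

  cost-betweenF : ∀ c a b → cost (betweenF c a b) ≤ 42
  cost-betweenF c a b = +-monoˡ-≤ 1 (+-monoˡ-≤ 1 (+-mono-≤ (*-monoʳ-≤ 2 (+-monoˡ-≤ 1 (cost-& a c b)))
                                                          (*-monoʳ-≤ 2 (+-monoˡ-≤ 1 (cost-& b c a)))))
    where
      cost-& : ∀ x y z → cost (precedesF x y & precedesF y z) ≤ 9
      cost-& x y z = +-monoˡ-≤ 1 (+-mono-≤ (*-monoʳ-≤ 2 (cost-precedesF x y)) (*-monoʳ-≤ 2 (cost-precedesF y z)))

  scratch-crossesF : ∀ f f' → scratch (crossesF f f') ≤ 4
  scratch-crossesF (a , b) (c , d) with not (a == c ∨ a == d ∨ b == c ∨ b == d)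
  ... | true = ⊔-lub (≤-reflexive (scratch-betweenF c a b)) (≤-reflexive (scratch-betweenF d a b))
  ... | false = z≤n

  cost-crossesF : ∀ f f' → cost (crossesF f f') ≤ 84
  cost-crossesF (a , b) (c , d) with not (a == c ∨ a == d ∨ b == c ∨ b == d)
  ... | true = +-mono-≤ (cost-betweenF c a b) (cost-betweenF d a b)
  ... | false = z≤n

  All-crossingFormulas : ∀ {P : Formula → Set} → (∀ f f' → P (crossesF f f')) → ∀ fs → All P (crossingFormulas fs)
  All-crossingFormulas P-cross [] = []
  All-crossingFormulas {P} P-cross (f ∷ fs) = ++⁺ (All-map fs) (All-crossingFormulas P-cross fs)
    where
      All-map : ∀ fs → All P (map (crossesF f) fs)
      All-map [] = []
      All-map (f' ∷ fs) = P-cross f f' ∷ All-map fs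

  pairCount≤length² : ∀ fs → pairCount fs ≤ length fs * length fs
  pairCount≤length² [] = z≤n
  pairCount≤length² (f ∷ fs) =
    ≤-trans (+-monoʳ-≤ (length fs) (pairCount≤length² fs))
      (≤-trans (m≤n+m _ (suc (length fs))) (≤-reflexive (regroup (length fs))))
    where
      regroup : ∀ k → suc k + (k + k * k) ≡ suc k * suc k
      regroup = solve-∀

numEdges≤n² : ∀ {n} (G : Graph n) → numEdges G ≤ n * n
numEdges≤n² {n} G = injective⇒≤ {f = code} code-injective
  where
    es = Graph.edges G
    code : Fin (length es) → Fin (n * n)
    code i = combine (proj₁ (List.lookup es i)) (proj₂ (List.lookup es i))
    code-injective : ∀ {i j} → code i ≡ code j → i ≡ j
    code-injective {i} {j} e with combine-injective _ _ _ _ e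
    ... | e₁ , e₂ = lookup-injective es (Graph.noDup G) i j (cong₂ _,_ e₁ e₂)

n<2^n : ∀ n → n < 2 ^ n
n<2^n zero = z<s
n<2^n (suc n) = begin-strict
    suc n
  ≤⟨ n<2^n n ⟩
    2 ^ n
  <⟨ m<m+n (2 ^ n) (≤-<-trans z≤n (n<2^n n)) ⟩
    2 ^ n + 2 ^ n
  ≡⟨ cong (2 ^ n +_) (sym (+-identityʳ (2 ^ n))) ⟩
    2 * 2 ^ n
  ∎
  where open ≤-Reasoning

-- A counter of P ⊓ 4n bits already holds P whenever P ≤ n⁴.
counterWidth : ℕ → ℕ → ℕ
counterWidth P n = P ⊓ (4 * n)

<2^counterWidth : ∀ P n → P ≤ n ^ 4 → P < 2 ^ counterWidth P n
<2^counterWidth P n P≤n⁴ with P ≤? 4 * n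
... | yes P≤4n = subst (λ B → P < 2 ^ B) (sym (m≤n⇒m⊓n≡m {P} {4 * n} P≤4n)) (n<2^n P)
... | no P≰4n = subst (λ B → P < 2 ^ B) (sym (m≥n⇒m⊓n≡n {P} {4 * n} (<⇒≤ (≰⇒> P≰4n)))) (
  ≤-<-trans P≤n⁴ (<-≤-trans (^-monoˡ-< 4 (n<2^n n)) (≤-reflexive (trans (^-*-assoc 2 n 4) (cong (2 ^_) (*-comm n 4))))))

n^[1+a]≤n^[1+b] : ∀ n a b → a ≤ b → n ^ suc a ≤ n ^ suc b
n^[1+a]≤n^[1+b] zero _ _ _ = z≤n
n^[1+a]≤n^[1+b] (suc k) _ _ a≤b = ^-monoʳ-≤ (suc k) (s≤s a≤b)

T-injective : ∀ {b c} → (T b → T c) → (T c → T b) → b ≡ c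
T-injective {true} {true} _ _ = refl
T-injective {true} {false} b⇒c _ = ⊥-elim (b⇒c tt)
T-injective {false} {true} _ c⇒b = ⊥-elim (c⇒b tt)
T-injective {false} {false} _ _ = refl

-- Started at 2 ^ B - (ρ ⊓ P + 1), the counter stays below 2 ^ B iff at most ρ bits were added.
threshold : ∀ B P ρ count → P < 2 ^ B → count ≤ P → (2 ^ B ∸ suc (ρ ⊓ P) + count <ᵇ 2 ^ B) ≡ (count ≤ᵇ ρ)
threshold B P ρ count P<2^B count≤P = T-injective to from
  where
    K = 2 ^ B ∸ suc (ρ ⊓ P)
    K+ρ⊓P+1 : K + suc (ρ ⊓ P) ≡ 2 ^ B
    K+ρ⊓P+1 = m∸n+n≡m (≤-<-trans (m⊓n≤n ρ P) P<2^B)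
    to : T (K + count <ᵇ 2 ^ B) → T (count ≤ᵇ ρ)
    to t = ≤⇒≤ᵇ (≤-trans (s≤s⁻¹ (+-cancelˡ-< K count (suc (ρ ⊓ P)) (subst (K + count <_) (sym K+ρ⊓P+1) (<ᵇ⇒< _ _ t))))
                         (m⊓n≤m ρ P))
    from : T (count ≤ᵇ ρ) → T (K + count <ᵇ 2 ^ B)
    from t = <⇒<ᵇ (subst (K + count <_) K+ρ⊓P+1 (+-monoʳ-< K (s≤s (⊓-glb (≤ᵇ⇒≤ count ρ t) count≤P))))

module Oracle {n : ℕ} (G : Graph n) (ρ : ℕ) where
  open Crossings n

  edges = Graph.edges G
  P = pairCount edges
  B = counterWidth P n
  NP = numPairs n

  -- qubits: 0 ↦ f(φ), 1 … NP ↦ x, then the hub, the result bit, the counter (B + 1),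
  -- the carries (B + 1), four scratch qubits, and finally the target qubit W
  hub res ctr car scr h W : ℕ
  hub = suc NP
  res = suc hub
  ctr = suc res
  car = ctr + suc B
  scr = car + suc B
  h = 2 * B + 8
  W = NP + (h + 1)

  scr+4≡W : scr + 4 ≡ W
  scr+4≡W = regroup NP B
    where
      regroup : ∀ a b → suc (suc (suc a)) + suc b + suc b + 4 ≡ a + (2 * b + 8 + 1)
      regroup = solve-∀

  K : ℕ
  K = 2 ^ B ∸ suc (ρ ⊓ P)

  prog : List Assignment
  prog = countingProgram B ctr car res K (crossingFormulas edges) (var 0)

  P≤n⁴ : P ≤ n ^ 4
  P≤n⁴ = ≤-trans (pairCount≤length² edges)
           (≤-trans (*-mono-≤ (numEdges≤n² G) (numEdges≤n² G)) (≤-reflexive (regroup n)))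
    where
      regroup : ∀ n → n * n * (n * n) ≡ n * (n * (n * (n * 1)))
      regroup = solve-∀

  P<2^B : P < 2 ^ B
  P<2^B = <2^counterWidth P n P≤n⁴

  open Wires W

  ctr+i<car : ∀ {i} → i ≤ B → ctr + i < car
  ctr+i<car i≤B = +-monoʳ-< ctr (s≤s i≤B)
  car+i<scr : ∀ {i} → i ≤ B → car + i < scr
  car+i<scr i≤B = +-monoʳ-< car (s≤s i≤B)
  hub<ctr+i : ∀ i → hub < ctr + i
  hub<ctr+i i = <-≤-trans (<-trans (n<1+n hub) (n<1+n res)) (m≤m+n ctr i)
  car<scr : car < scr
  car<scr = m<m+n car z<s
  ctr<car : ctr < car
  ctr<car = m<m+n ctr z<s
  hub<car : hub < car
  hub<car = <-trans (<-trans (n<1+n hub) (n<1+n res)) ctr<car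
  scr<W : scr < W
  scr<W = subst (scr <_) scr+4≡W (m<m+n scr z<s)
  hub<W : hub < W
  hub<W = <-trans hub<car (<-trans car<scr scr<W)
  res<W : res < W
  res<W = <-trans (n<1+n res) (<-trans ctr<car (<-trans car<scr scr<W))

  Ordinary : ℕ → Set
  Ordinary k = k < W × k ≢ hub

  below-hub : ∀ {k} → k < hub → Ordinary k
  below-hub k<hub = <-trans k<hub hub<W , <⇒≢ k<hub

  above-hub : ∀ {k} → hub < k → k < scr → Ordinary k
  above-hub hub<k k<scr = <-trans k<scr scr<W , λ k≡hub → <⇒≢ hub<k (sym k≡hub)

  Good : Assignment → Set
  Good (t , F) = Fits scr 4 (t , F) × AllVars Ordinary F × Ordinary t × cost F ≤ 84

  good-set : ∀ i → i < suc B → Good (ctr + i , TT)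
  good-set i i≤B = (t<scr , tt , tt , z≤n) , tt , above-hub (hub<ctr+i i) t<scr , s≤s z≤n
    where t<scr = <-trans (ctr+i<car (s≤s⁻¹ i≤B)) (<-≤-trans car<scr ≤-refl)

  good-carry : ∀ i → i < B → Good (suc (car + i) , var (car + i) & var (ctr + i))
  good-carry i i<B =
    (t<scr , (car+i<scr (<⇒≤ i<B) , ctr+i<scr) , (<⇒≢ (n<1+n _) , <⇒≢ (<-trans ctr+i<car+i (n<1+n _))) , s≤s (s≤s z≤n)) ,
    (above-hub (<-≤-trans hub<car (m≤m+n car i)) (car+i<scr (<⇒≤ i<B)) , above-hub (hub<ctr+i i) ctr+i<scr) ,
    above-hub (<-≤-trans hub<car (≤-trans (m≤m+n car i) (n≤1+n _))) t<scr ,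
    m≤m+n 5 79
    where
      t<scr : suc (car + i) < scr
      t<scr = subst (_< scr) (+-suc car i) (car+i<scr i<B)
      ctr+i<car+i : ctr + i < car + i
      ctr+i<car+i = +-monoˡ-< i ctr<car
      ctr+i<scr = <-trans (ctr+i<car (<⇒≤ i<B)) (<-≤-trans car<scr ≤-refl)

  good-add : ∀ i → i ≤ B → Good (ctr + i , var (car + i))
  good-add i i≤B =
    (t<scr , car+i<scr i≤B , (λ e → <⇒≢ (<-≤-trans (ctr+i<car i≤B) (m≤m+n car i)) (sym e)) , z≤n) ,
    above-hub (<-≤-trans hub<car (m≤m+n car i)) (car+i<scr i≤B) , above-hub (hub<ctr+i i) t<scr , s≤s z≤n
    where t<scr = <-trans (ctr+i<car i≤B) car<scr

  good-crossing : ∀ f f' → Good (car , crossesF f f')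
  good-crossing f f' =
    (car<scr , AllVars-map (λ k<hub → <-trans k<hub (<-trans hub<car car<scr)) F vars<hub ,
      AllVars-<⇒≢ F (<⇒≤ hub<car) vars<hub , scratch-crossesF f f') ,
    AllVars-map below-hub F vars<hub , above-hub hub<car car<scr , cost-crossesF f f'
    where
      F = crossesF f f'
      vars<hub : AllVars (_< hub) F
      vars<hub = crossesF-vars xIndex< f f'

  good-read : Good (res , var 0 & neg (var (ctr + B)))
  good-read =
    (res<scr , (z<s , ctr+B<scr) , ((λ ()) , (λ e → <⇒≢ (<-≤-trans (n<1+n res) (m≤m+n ctr B)) (sym e))) , s≤s (s≤s z≤n)) ,
    (below-hub z<s , above-hub (hub<ctr+i B) ctr+B<scr) , above-hub (n<1+n hub) res<scr , m≤m+n 7 77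
    where
      ctr+B<scr = <-trans (ctr+i<car ≤-refl) car<scr
      res<scr = <-trans (n<1+n res) (≤-<-trans (m≤m+n ctr B) ctr+B<scr)

  prog-good : All Good prog
  prog-good = ++⁺ (setConstant-All K ctr (suc B) good-set)
                  (++⁺ (addBits-All B ctr car _ (All-crossingFormulas good-crossing edges)
                                     (increment-All B ctr car good-carry good-add))
                       (good-read ∷ []))

  Hub Target Result : Fin (suc W)
  Hub = wire hub
  Target = wire W
  Result = wire res

  Result≢Hub : Result ≢ Hub
  Result≢Hub = wire-≢ (<⇒≤ res<W) (<⇒≤ hub<W) (λ e → <⇒≢ (n<1+n hub) (sym e))
  Hub≢Target : Hub ≢ Target
  Hub≢Target = wire-≢ (<⇒≤ hub<W) ≤-refl (<⇒≢ hub<W)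

  compiled : Circuit (suc W)
  compiled = compileProgram scr prog

  compute : Circuit (suc W)
  compute = ViaHub.viaHubAll Hub compiled ++ (CNOT Result Hub Result≢Hub ∷ [])

  OPCM : Circuit (suc W)
  OPCM = compute ++ (CNOT Hub Target Hub≢Target ∷ reverse compute)

  OffHubAndTarget : Fin (suc W) → Set
  OffHubAndTarget x = x ≢ Hub × x ≢ Target

  ordinary-wire : ∀ {k} → Ordinary k → OffHubAndTarget (wire k)
  ordinary-wire (k<W , k≢hub) = wire-≢ (<⇒≤ k<W) (<⇒≤ hub<W) k≢hub , wire-≢ (<⇒≤ k<W) ≤-refl (<⇒≢ k<W)

  compiled-uses : UsesOnly OffHubAndTarget compiled
  compiled-uses = compileProgram-uses OffHubAndTarget scr 4 prog
    (All.map (λ { {t , F} ((_ , _ , _ , F≤4) , F-ord , t-ord , _) → AllVars-map ordinary-wire F F-ord , ordinary-wire t-ord , F≤4 })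
             prog-good)
    (λ i i<4 → ordinary-wire (subst (scr + i <_) scr+4≡W (+-monoʳ-< scr i<4) ,
                              λ e → <⇒≢ (<-≤-trans (<-trans hub<car car<scr) (m≤m+n scr i)) (sym e)))

  open ViaHub Hub using (viaHubAll-correct; viaHubAll-touches; viaHubAll-avoids; viaHubAll-length)

  compute-avoids-Target : All (Avoids Target) compute
  compute-avoids-Target =
    ++⁺ (viaHubAll-avoids compiled Target (λ e → Hub≢Target (sym e)) (All.map (All.map proj₂) compiled-uses))
        ((Result≢Target ∷ Hub≢Target ∷ []) ∷ [])
    where
      Result≢Target : Result ≢ Target
      Result≢Target = wire-≢ (<⇒≤ res<W) ≤-refl (<⇒≢ res<W)

  OPCM-touches-Hub : All (λ g → Hub ∈ wires g) OPCM
  OPCM-touches-Hub = ++⁺ compute-touches (here refl ∷ All-reverse compute-touches)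
    where
      compute-touches : All (λ g → Hub ∈ wires g) compute
      compute-touches = ++⁺ (viaHubAll-touches compiled) (there (here refl) ∷ [])

  module Input (φ : Phi n) where
    I : Bool → Vec Bool (suc W)
    I β = basisIn φ h β

    private
      ancillas : Bool → Vec Bool (h + 1)
      ancillas β = replicate h false Vec.++ (β ∷ [])

      W≡1+NP+h : W ≡ suc (NP + h)
      W≡1+NP+h = trans (cong (NP +_) (+-comm h 1)) (+-suc NP h)

    I-ancilla : ∀ β q → hub ≤ q → q < W → nth (I β) q ≡ false
    I-ancilla β (suc q) (s≤s NP≤q) q<W = begin
        nth (xVec φ Vec.++ ancillas β) q
      ≡⟨ cong (nth (xVec φ Vec.++ ancillas β)) (sym q≡) ⟩
        nth (xVec φ Vec.++ ancillas β) (NP + i)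
      ≡⟨ nth-++ʳ (xVec φ) (ancillas β) i ⟩
        nth (ancillas β) i
      ≡⟨ nth-++ˡ (replicate h false) (β ∷ []) i i<h ⟩
        nth (replicate h false) i
      ≡⟨ nth-replicate-false h i ⟩
        false
      ∎
      where
        open ≡-Reasoning
        i = q ∸ NP
        q≡ : NP + i ≡ q
        q≡ = m+[n∸m]≡n NP≤q
        i<h : i < h
        i<h = +-cancelˡ-< NP i h (s≤s⁻¹ (subst (suc (NP + i) <_) W≡1+NP+h (subst (λ x → suc x < W) (sym q≡) q<W)))

    I-x : ∀ β k → k < NP → nth (I β) (suc k) ≡ nth (xVec φ) k
    I-x β k k<NP = nth-++ˡ (xVec φ) (ancillas β) k k<NP

    I-target : ∀ β → nth (I β) W ≡ β
    I-target β = subst (λ x → nth (I β) x ≡ β) (sym W≡1+NP+h)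
      (trans (nth-++ʳ (xVec φ) (ancillas β) h)
             (trans (cong (nth (ancillas β)) (sym (+-identityʳ h))) (nth-++ʳ (replicate h false) (β ∷ []) 0)))

    I-below-target : ∀ β β' q → q < W → nth (I β) q ≡ nth (I β') q
    I-below-target β β' zero _ = refl
    I-below-target β β' (suc q) q<W with q <? NP
    ... | yes q<NP = trans (I-x β q q<NP) (sym (I-x β' q q<NP))
    ... | no q≮NP = trans (I-ancilla β (suc q) (s≤s (≮⇒≥ q≮NP)) q<W) (sym (I-ancilla β' (suc q) (s≤s (≮⇒≥ q≮NP)) q<W))

    flipAt-I : ∀ β → flipAt Target (I β) ≡ I (not β)
    flipAt-I β = nth-ext _ _ same
      where
        same : ∀ q → q < suc W → nth (flipAt Target (I β)) q ≡ nth (I (not β)) q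
        same q q≤W with q ≟ W
        ... | yes refl = trans (subst (λ x → nth (flipAt Target (I β)) x ≡ not (nth (I β) x)) (toℕ-wire W ≤-refl)
                                      (nth-flipAt-same (I β) Target))
                               (trans (cong not (I-target β)) (sym (I-target (not β))))
        ... | no q≢W = trans (nth-flipAt-other (I β) Target q (λ e → q≢W (trans e (toℕ-wire W ≤-refl))))
                             (I-below-target β (not β) q (≤∧≢⇒< (s≤s⁻¹ q≤W) q≢W))

    g : Bool
    g = gX G ρ φ ∧ fPhi φ

    private
      Zs = crossingFormulas edges
      hub<ctr : hub < ctr
      hub<ctr = <-trans (n<1+n hub) (n<1+n res)

      ρ-room : K + suc (ρ ⊓ P) ≡ 2 ^ B
      ρ-room = m∸n+n≡m (≤-<-trans (m⊓n≤n ρ P) P<2^B)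

      no-overflow : K + length Zs < 2 ^ suc B
      no-overflow = subst (λ x → K + x < 2 ^ suc B) (sym (length-crossingFormulas edges))
        (<-≤-trans (+-mono-< (subst (K <_) ρ-room (m<m+n K z<s)) P<2^B) (≤-reflexive (cong (2 ^ B +_) (sym (+-identityʳ (2 ^ B))))))

      Zs<ctr : All (AllVars (_< ctr)) Zs
      Zs<ctr = All-crossingFormulas
        (λ f f' → AllVars-map (λ k<hub → <-trans k<hub hub<ctr) (crossesF f f') (crossesF-vars xIndex< f f')) edges

    counting : ∀ β → exec prog (nth (I β)) res ≡ fPhi φ ∧ (K + crossCount φ edges <ᵇ 2 ^ B)
                   × (∀ q → q < ctr → q ≢ res → exec prog (nth (I β)) q ≡ nth (I β) q)
    counting β = trans (proj₁ correct) (cong (λ c → fPhi φ ∧ (K + c <ᵇ 2 ^ B)) crossings) , proj₂ correct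
      where
        correct = countingProgram-correct B ctr car res K Zs (var 0) (nth (I β))
          (n<1+n res) (ctr+i<car ≤-refl) (I-ancilla β res (n≤1+n hub) res<W)
          (λ q ctr≤q q< → I-ancilla β q (≤-trans (<⇒≤ hub<ctr) ctr≤q) (<-trans q< (<-trans car<scr scr<W)))
          (λ q car≤q q< → I-ancilla β q (≤-trans (<⇒≤ hub<car) car≤q)
                                        (<-trans (≤-<-trans (s≤s⁻¹ q<) (car+i<scr ≤-refl)) scr<W))
          Zs<ctr z<s (λ ()) no-overflow
        crossings : countTrue (nth (I β)) Zs ≡ crossCount φ edges
        crossings = countTrue-crossingFormulas φ (nth (I β)) (holdsX φ (nth (I β)) (I-x β)) edges

    hub-I : ∀ β → lookup (fwd compute (I β)) Hub ≡ g
    hub-I β = begin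
        lookup (fwd compute (I β)) Hub
      ≡⟨ cong (λ v → lookup v Hub) (fwd-++ (ViaHub.viaHubAll Hub compiled) (copy-gate ∷ []) (I β)) ⟩
        lookup (basisAct copy-gate (fwd (ViaHub.viaHubAll Hub compiled) (I β))) Hub
      ≡⟨ cong (λ v → lookup (basisAct copy-gate v) Hub) (viaHubAll-correct compiled (I β) compiled-avoids-Hub I-hub) ⟩
        lookup (basisAct copy-gate s) Hub
      ≡⟨ copied ⟩
        lookup s Result
      ≡⟨ trans (nth-wire s res (<⇒≤ res<W)) (run-prog res (<⇒≤ res<W)) ⟩
        exec prog (nth (I β)) res
      ≡⟨ proj₁ (counting β) ⟩
        fPhi φ ∧ (K + crossCount φ edges <ᵇ 2 ^ B)
      ≡⟨ cong (fPhi φ ∧_) (threshold B P ρ (crossCount φ edges) P<2^B (crossCount≤pairCount φ edges)) ⟩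
        fPhi φ ∧ (crossCount φ edges ≤ᵇ ρ)
      ≡⟨ ∧-duplicate (fPhi φ) _ ⟩
        g
      ∎
      where
        open ≡-Reasoning
        copy-gate = CNOT Result Hub Result≢Hub
        s = fwd compiled (I β)
        compiled-avoids-Hub : All (Avoids Hub) compiled
        compiled-avoids-Hub = All.map (All.map proj₁) compiled-uses
        I-hub : lookup (I β) Hub ≡ false
        I-hub = trans (nth-wire (I β) hub (<⇒≤ hub<W)) (I-ancilla β hub ≤-refl hub<W)
        run-prog : ∀ q → q ≤ W → nth s q ≡ exec prog (nth (I β)) q
        run-prog = compileProgram-correct scr 4 prog (I β) (nth (I β)) (≤-reflexive scr+4≡W) (All.map proj₁ prog-good)
          (λ q scr≤q q< → I-ancilla β q (≤-trans (<⇒≤ (<-trans hub<car car<scr)) scr≤q) (subst (q <_) scr+4≡W q<))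
          (λ _ _ → refl)
        s-hub : lookup s Hub ≡ false
        s-hub = trans (nth-wire s hub (<⇒≤ hub<W)) (trans (run-prog hub (<⇒≤ hub<W))
                  (trans (proj₂ (counting β) hub hub<ctr (<⇒≢ (n<1+n hub))) (I-ancilla β hub ≤-refl hub<W)))
        copied : lookup (basisAct copy-gate s) Hub ≡ lookup s Result
        copied with lookup s Result
        ... | true = trans (lookup∘updateAt Hub s) (cong not s-hub)
        ... | false = s-hub
        ∧-duplicate : ∀ f c → f ∧ c ≡ (f ∧ c) ∧ f
        ∧-duplicate true c = sym (∧-identityʳ c)
        ∧-duplicate false c = refl

  OPCM-correct : ∀ φ b → run OPCM (inputState φ h) b ≡ sign (gX G ρ φ ∧ fPhi φ) (inputState φ h b)
  OPCM-correct φ = PhaseKickback.kickback compute Hub Target Hub≢Target I g compute-avoids-Target flipAt-I hub-I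
    where open Input φ

  B≤P : B ≤ P
  B≤P = m⊓n≤m P (4 * n)

  B≤4n : B ≤ 4 * n
  B≤4n = m⊓n≤n P (4 * n)

  length-prog : length prog ≤ suc B + (P * (3 * B + 3) + 1)
  length-prog = begin
      length prog
    ≡⟨ length-++ (setConstant K ctr (suc B)) ⟩
      length (setConstant K ctr (suc B)) + length (addBits B ctr car Zs ++ _)
    ≡⟨ cong (length (setConstant K ctr (suc B)) +_) (length-++ (addBits B ctr car Zs)) ⟩
      length (setConstant K ctr (suc B)) + (length (addBits B ctr car Zs) + 1)
    ≤⟨ +-mono-≤ (length-setConstant K ctr (suc B))
                (≤-reflexive (cong (_+ 1) (trans (length-addBits B ctr car Zs) (cong (_* (3 * B + 3)) (length-crossingFormulas edges))))) ⟩
      suc B + (P * (3 * B + 3) + 1)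
    ∎
    where
      open ≤-Reasoning
      Zs = crossingFormulas edges

  length-OPCM : length OPCM ≤ 2 * (3 * (84 * length prog) + 1) + 1
  length-OPCM = begin
      length (compute ++ (CNOT Hub Target Hub≢Target ∷ reverse compute))
    ≡⟨ trans (length-++ compute) (cong (λ x → length compute + suc x) (length-reverse compute)) ⟩
      length compute + suc (length compute)
    ≡⟨ regroup (length compute) ⟩
      2 * length compute + 1
    ≤⟨ +-monoˡ-≤ 1 (*-monoʳ-≤ 2 length-compute) ⟩
      2 * (3 * (84 * length prog) + 1) + 1
    ∎
    where
      open ≤-Reasoning
      regroup : ∀ x → x + suc x ≡ 2 * x + 1
      regroup = solve-∀
      length-compiled : length compiled ≤ 84 * length prog
      length-compiled = compileProgram-length scr 84 prog (All.map (λ good → proj₂ (proj₂ (proj₂ good))) prog-good)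
      length-compute : length compute ≤ 3 * (84 * length prog) + 1
      length-compute = ≤-trans (≤-reflexive (length-++ (ViaHub.viaHubAll Hub compiled)))
                         (+-monoˡ-≤ 1 (≤-trans (viaHubAll-length compiled) (*-monoʳ-≤ 3 length-compiled)))

  length-OPCM≤ : length OPCM ≤ 10000 * (1 + n ^ 6)
  length-OPCM≤ = begin
      length OPCM
    ≤⟨ length-OPCM ⟩
      2 * (3 * (84 * length prog) + 1) + 1
    ≤⟨ +-monoˡ-≤ 1 (*-monoʳ-≤ 2 (+-monoˡ-≤ 1 (*-monoʳ-≤ 3 (*-monoʳ-≤ 84 length-prog≤)))) ⟩
      2 * (3 * (84 * (19 * n ^ 6 + 2)) + 1) + 1
    ≤⟨ expand (n ^ 6) ⟩
      10000 * (1 + n ^ 6)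
    ∎
    where
      open ≤-Reasoning
      n≤n⁶ : n ≤ n ^ 6
      n≤n⁶ = ≤-trans (≤-reflexive (sym (*-identityʳ n))) (n^[1+a]≤n^[1+b] n 0 5 z≤n)
      length-prog≤ : length prog ≤ 19 * n ^ 6 + 2
      length-prog≤ = begin
          length prog
        ≤⟨ length-prog ⟩
          suc B + (P * (3 * B + 3) + 1)
        ≤⟨ +-mono-≤ (s≤s B≤4n) (+-monoˡ-≤ 1 (*-mono-≤ P≤n⁴ (+-monoˡ-≤ 3 (*-monoʳ-≤ 3 B≤4n)))) ⟩
          suc (4 * n) + (n ^ 4 * (3 * (4 * n) + 3) + 1)
        ≡⟨ regroup n (n ^ 4) ⟩
          4 * n + 12 * n ^ 5 + 3 * n ^ 4 + 2
        ≤⟨ +-monoˡ-≤ 2 (+-mono-≤ (+-mono-≤ (*-monoʳ-≤ 4 n≤n⁶) (*-monoʳ-≤ 12 (n^[1+a]≤n^[1+b] n 4 5 (n≤1+n 4))))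
                                 (*-monoʳ-≤ 3 (n^[1+a]≤n^[1+b] n 3 5 (m≤m+n 3 2)))) ⟩
          4 * n ^ 6 + 12 * n ^ 6 + 3 * n ^ 6 + 2
        ≡⟨ collect (n ^ 6) ⟩
          19 * n ^ 6 + 2
        ∎
        where
          regroup : ∀ n x → suc (4 * n) + (x * (3 * (4 * n) + 3) + 1) ≡ 4 * n + 12 * (n * x) + 3 * x + 2
          regroup = solve-∀
          collect : ∀ N → 4 * N + 12 * N + 3 * N + 2 ≡ 19 * N + 2
          collect = solve-∀
      expand : ∀ N → 2 * (3 * (84 * (19 * N + 2)) + 1) + 1 ≤ 10000 * (1 + N)
      expand N = begin
          2 * (3 * (84 * (19 * N + 2)) + 1) + 1
        ≡⟨ normalise N ⟩
          9576 * N + 1011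
        ≤⟨ +-mono-≤ (*-monoˡ-≤ N (m≤m+n 9576 424)) (m≤m+n 1011 8989) ⟩
          10000 * N + 10000
        ≡⟨ trans (+-comm (10000 * N) 10000) (sym (*-distribˡ-+ 10000 1 N)) ⟩
          10000 * (1 + N)
        ∎
        where
          normalise : ∀ N → 2 * (3 * (84 * (19 * N + 2)) + 1) + 1 ≡ 9576 * N + 1011
          normalise = solve-∀

  h≤ : h ≤ 10000 * (1 + numEdges G ^ 2)
  h≤ = ≤-trans (+-monoˡ-≤ 8 (*-monoʳ-≤ 2 B≤m²)) (widen (numEdges G ^ 2))
    where
      B≤m² : B ≤ numEdges G ^ 2
      B≤m² = ≤-trans B≤P (≤-trans (pairCount≤length² edges)
                                  (≤-reflexive (cong (numEdges G *_) (sym (*-identityʳ (numEdges G))))))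
      widen : ∀ M → 2 * M + 8 ≤ 10000 * (1 + M)
      widen M = ≤-trans (+-mono-≤ (*-monoˡ-≤ M (m≤m+n 2 9998)) (m≤m+n 8 9992))
                        (≤-reflexive (trans (+-comm (10000 * M) 10000) (sym (*-distribˡ-+ 10000 1 M))))

-- The construction works for every ρ.
lemma12 : Σ ℕ λ c →
    ∀ (n : ℕ) (G : Graph n) (ρ : ℕ) → 1 ≤ ρ →
    Σ ℕ λ h → Σ (Circuit (regWidth n h)) λ OPCM →
      (h ≤ c * (1 + numEdges G ^ 2))
      × (∀ (φ : Phi n) (b : Vec Bool (regWidth n h)) →
           run OPCM (inputState φ h) b ≡ sign (gX G ρ φ ∧ fPhi φ) (inputState φ h b))
      × (complexity OPCM ≤ c * (1 + n ^ 8))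
      × DepthAtMost OPCM (c * (1 + n ^ 6))
      × WidthAtMost OPCM (c * (1 + numEdges G ^ 2))
lemma12 = 10000 , λ n G ρ _ → let open Oracle G ρ in
  h , OPCM , h≤ , OPCM-correct ,
  ≤-trans length-OPCM≤ (*-monoʳ-≤ 10000 (+-monoʳ-≤ 1 (n^[1+a]≤n^[1+b] n 5 7 (m≤m+n 5 2)))) ,
  depth≤length OPCM length-OPCM≤ ,
  λ A antichain → ≤-trans (width≤1 OPCM Hub OPCM-touches-Hub A antichain) (m≤m+n 1 _)
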